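{- For $y\in\mathcal I_\infty$, the set of visible inversions of $y$ equals $\mathrm{Inv}(\alpha_{\min}(y))=\{(i,j):i<j,\ \alpha_{\min}(y)(i)>\alpha_{\min}(y)(j)\}$.
   Context: $\mathcal I_\infty$ is the set of involutions of the positive integers with finite support. A visible inversion of $y$ is a pair $(i,j)$ of integers with $i<j$ and $y(j)\le\min\{i,y(i)\}$. The atoms $\mathcal A(y)$ are the minimal-length permutations $w$ with $w^{ -1}\circ w=y$, where $\circ$ is the Demazure product (associative, $u\circ v=uv$ when $\ell(uv)=\ell(u)+\ell(v)$, $s_i\circ s_i=s_i$ with $s_i=(i,i+1)$); $\alpha_{\min}(y)$ is the lexicographically minimal element of $\mathcal A(y)$ with respect to one-line notation. -}

module Defs where

open import Data.Nat using (ℕ; zero; suc; _<_; _≤_; _⊓_; _<ᵇ_; _≟_)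
open import Data.Bool using (if_then_else_)
open import Data.List using (List; []; _∷_; _++_; length; foldl)
open import Data.Product using (Σ; ∃; _×_)
open import Data.Sum using (_⊎_)
open import Relation.Nullary using (yes; no; ¬_)
open import Relation.Binary.PropositionalEquality using (_≡_)

-- Convention: the positive integer p is encoded by the natural number p - 1.
-- All notions below (one-line notation, s_k, inversions, visible
-- inversions, lexicographic order) are invariant under this shift.

FinSupp : (ℕ → ℕ) → Set
FinSupp f = ∃ λ n → ∀ i → n ≤ i → f i ≡ i

IsInverse : (ℕ → ℕ) → (ℕ → ℕ) → Set
IsInverse g f = (∀ i → g (f i) ≡ i) × (∀ i → f (g i) ≡ i)

FinPerm : (ℕ → ℕ) → Set
FinPerm w = (∃ λ g → IsInverse g w) × FinSupp w

IsInvolution : (ℕ → ℕ) → Set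
IsInvolution y = (∀ i → y (y i) ≡ i) × FinSupp y

swap : ℕ → ℕ → ℕ
swap k i with i ≟ k
... | yes _ = suc k
... | no _ with i ≟ suc k
...   | yes _ = k
...   | no _ = i

act : List ℕ → ℕ → ℕ
act [] i = i
act (k ∷ a) i = swap k (act a i)

Rep : List ℕ → (ℕ → ℕ) → Set
Rep a w = ∀ i → act a i ≡ w i

Reduced : List ℕ → (ℕ → ℕ) → Set
Reduced a w = Rep a w × (∀ b → Rep b w → length a ≤ length b)

-- Demazure product of a word: s_{a1} ∘ s_{a2} ∘ ... ∘ s_{am}, computed left
-- to right via  w ∘ s_k = w s_k if w(k) < w(k+1), and = w otherwise.
demStep : (ℕ → ℕ) → ℕ → (ℕ → ℕ)
demStep w k = if w k <ᵇ w (suc k) then (λ x → w (swap k x)) else w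

dem : List ℕ → ℕ → ℕ
dem a = foldl demStep (λ x → x) a

DemProd : (ℕ → ℕ) → (ℕ → ℕ) → (ℕ → ℕ) → Set
DemProd u v z = ∃ λ a → ∃ λ b → Reduced a u × Reduced b v × (∀ i → dem (a ++ b) i ≡ z i)

InvDem : (ℕ → ℕ) → (ℕ → ℕ) → Set
InvDem y w = ∃ λ g → IsInverse g w × DemProd g w y

IsAtom : (ℕ → ℕ) → (ℕ → ℕ) → Set
IsAtom y w = FinPerm w × InvDem y w ×
  (∀ v → FinPerm v → InvDem y v →
     ∀ a b → Reduced a w → Reduced b v → length a ≤ length b)

_≤lex_ : (ℕ → ℕ) → (ℕ → ℕ) → Set
w ≤lex v = (∀ i → w i ≡ v i) ⊎ (∃ λ k → (∀ i → i < k → w i ≡ v i) × w k < v k)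

IsAlphaMin : (ℕ → ℕ) → (ℕ → ℕ) → Set
IsAlphaMin y w = IsAtom y w × (∀ v → IsAtom y v → w ≤lex v)

VisInv : (ℕ → ℕ) → ℕ → ℕ → Set
VisInv y i j = i < j × y j ≤ i ⊓ y i

Inv : (ℕ → ℕ) → ℕ → ℕ → Set
Inv w i j = i < j × w j < w i

module Submission where

-- Let b be a reduced word of an atom w of y. Reading b from the left, w⁻¹ ∘ w is built
-- from the identity by Demazure conjugations z ↦ s_k ∘ z ∘ s_k; a letter that is a descent of the
-- current involution leaves it unchanged, an ascent raises ℓ + κ by 2. The permutation c that ranks
-- the points by the minimum of their y-cycle, the larger point of each 2-cycle first, has a reduced
-- word made of ascents only, so ℓ(c) = (ℓ + κ)(y)/2 ≤ ℓ(w). Minimality of w forces equality, so all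
-- letters of b are ascents, and therefore w(b) < w(a) for every 2-cycle a < b of y. Any such w that
-- agrees with c before position k cannot have w(k) < c(k), by counting the points sent below c(k);
-- hence α_min(y) = c, and (i, j) is an inversion of c exactly when y(j) ≤ min(i, y(i)).

open import Defs
open import Data.Nat using (ℕ; zero; suc; _+_; _*_; _∸_; _≤_; _<_; _⊓_; _⊔_; _<ᵇ_; _≡ᵇ_; _≟_; _<?_; z≤n; s≤s)
open import Data.Nat.Properties
open import Data.Bool using (true; false; if_then_else_; _∧_)
open import Data.List using (List; []; _∷_; _++_; [_]; length; foldl; reverse)
open import Data.List.Properties using (++-assoc; length-++; foldl-++; unfold-reverse; length-reverse)
open import Data.Product using (Σ; ∃; _×_; _,_; proj₁; proj₂)
open import Data.Sum using (_⊎_; inj₁; inj₂)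
open import Data.Empty using (⊥-elim)
open import Data.Unit using (tt; ⊤)
open import Data.List.Relation.Unary.All using (All; []; _∷_)
open import Data.List.Relation.Unary.All.Properties using (++⁺)
open import Function using (_∘_)
open import Induction.WellFounded using (Acc; acc)
open import Data.Nat.Induction using (<-wellFounded)
open import Relation.Nullary using (yes; no; ¬_; Dec; _×-dec_)
open import Relation.Binary using (tri<; tri≈; tri>)
open import Relation.Binary.PropositionalEquality hiding ([_])
open import Algebra.Properties.CommutativeSemigroup +-commutativeSemigroup using () renaming (interchange to +-interchange)

Fn : Set
Fn = ℕ → ℕ

infix 4 _≐_
_≐_ : Fn → Fn → Set
f ≐ g = ∀ x → f x ≡ g x

Injective : Fn → Set
Injective u = ∀ {x x'} → u x ≡ u x' → x ≡ x'

Involutive : Fn → Set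
Involutive z = ∀ x → z (z x) ≡ x

involutive⇒injective : ∀ {z} → Involutive z → Injective z
involutive⇒injective {z} inv {x} {x'} e = trans (sym (inv x)) (trans (cong z e) (inv x'))

n≢1+n : ∀ n → n ≢ suc n
n≢1+n n = 1+n≢n ∘ sym

data SwapView (k : ℕ) : ℕ → Set where
  at-k     : SwapView k k
  at-suc-k : SwapView k (suc k)
  elsewhere : ∀ {x} → x ≢ k → x ≢ suc k → SwapView k x

swapView : ∀ k x → SwapView k x
swapView k x with x ≟ k | x ≟ suc k
... | yes refl | _        = at-k
... | no _     | yes refl = at-suc-k
... | no x≢k   | no x≢1+k = elsewhere x≢k x≢1+k

swap-fst : ∀ k → swap k k ≡ suc k
swap-fst k with k ≟ k
... | yes _ = refl
... | no k≢k = ⊥-elim (k≢k refl)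

swap-snd : ∀ k → swap k (suc k) ≡ k
swap-snd k with suc k ≟ k
... | yes 1+k≡k = ⊥-elim (1+n≢n 1+k≡k)
... | no _ with suc k ≟ suc k
...   | yes _ = refl
...   | no ne = ⊥-elim (ne refl)

swap-other : ∀ {k x} → x ≢ k → x ≢ suc k → swap k x ≡ x
swap-other {k} {x} x≢k x≢1+k with x ≟ k
... | yes x≡k = ⊥-elim (x≢k x≡k)
... | no _ with x ≟ suc k
...   | yes x≡1+k = ⊥-elim (x≢1+k x≡1+k)
...   | no _ = refl

swap-involutive : ∀ k x → swap k (swap k x) ≡ x
swap-involutive k x with swapView k x
... | at-k = trans (cong (swap k) (swap-fst k)) (swap-snd k)
... | at-suc-k = trans (cong (swap k) (swap-snd k)) (swap-fst k)
... | elsewhere x≢k x≢1+k = trans (cong (swap k) (swap-other x≢k x≢1+k)) (swap-other x≢k x≢1+k)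

swap-injective : ∀ k → Injective (swap k)
swap-injective k {x} {x'} e =
  trans (sym (swap-involutive k x)) (trans (cong (swap k) e) (swap-involutive k x'))

swap-fixes-above : ∀ {k x} → suc k < x → swap k x ≡ x
swap-fixes-above {k} k+1<x = swap-other (λ x≡k → n≮n k (subst (k <_) x≡k (<-trans (n<1+n k) k+1<x)))
                                       (λ x≡1+k → n≮n (suc k) (subst (suc k <_) x≡1+k k+1<x))

swap-bounded : ∀ {k x N} → suc k < N → x < N → swap k x < N
swap-bounded {k} {x} {N} k+1<N x<N with swapView k x
... | at-k = subst (_< N) (sym (swap-fst k)) k+1<N
... | at-suc-k = subst (_< N) (sym (swap-snd k)) (<-trans (n<1+n k) k+1<N)
... | elsewhere x≢k x≢1+k = subst (_< N) (sym (swap-other x≢k x≢1+k)) x<N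

swap-mono-< : ∀ k {a b} → a < b → ¬ (a ≡ k × b ≡ suc k) → swap k a < swap k b
swap-mono-< k {a} {b} a<b not-k,1+k with swapView k a | swapView k b
... | at-k | at-k = ⊥-elim (n≮n k a<b)
... | at-k | at-suc-k = ⊥-elim (not-k,1+k (refl , refl))
... | at-k | elsewhere b≢k b≢1+k =
  subst₂ _<_ (sym (swap-fst k)) (sym (swap-other b≢k b≢1+k)) (≤∧≢⇒< a<b (b≢1+k ∘ sym))
... | at-suc-k | at-k = ⊥-elim (<-asym a<b (n<1+n k))
... | at-suc-k | at-suc-k = ⊥-elim (n≮n (suc k) a<b)
... | at-suc-k | elsewhere b≢k b≢1+k =
  subst₂ _<_ (sym (swap-snd k)) (sym (swap-other b≢k b≢1+k)) (<-trans (n<1+n k) a<b)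
... | elsewhere a≢k a≢1+k | at-k =
  subst₂ _<_ (sym (swap-other a≢k a≢1+k)) (sym (swap-fst k)) (<-trans a<b (n<1+n k))
... | elsewhere a≢k a≢1+k | at-suc-k =
  subst₂ _<_ (sym (swap-other a≢k a≢1+k)) (sym (swap-snd k)) (≤∧≢⇒< (≤-pred a<b) a≢k)
... | elsewhere a≢k a≢1+k | elsewhere b≢k b≢1+k =
  subst₂ _<_ (sym (swap-other a≢k a≢1+k)) (sym (swap-other b≢k b≢1+k)) a<b

swap-reflects-< : ∀ k {a b} → swap k a < swap k b → ¬ (a ≡ suc k × b ≡ k) → a < b
swap-reflects-< k {a} {b} lt not-1+k,k =
  subst₂ _<_ (swap-involutive k a) (swap-involutive k b) (swap-mono-< k {swap k a} {swap k b} lt excluded)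
  where
  excluded : ¬ (swap k a ≡ k × swap k b ≡ suc k)
  excluded (ea , eb) = not-1+k,k
    ( trans (sym (swap-involutive k a)) (trans (cong (swap k) ea) (swap-fst k))
    , trans (sym (swap-involutive k b)) (trans (cong (swap k) eb) (swap-snd k)))

swap-<-reversed : ∀ k {a b} → swap k a < swap k b → ¬ a < b → a ≡ suc k × b ≡ k
swap-<-reversed k {a} {b} lt a≮b with a ≟ suc k ×-dec b ≟ k
... | yes reversed = reversed
... | no not-1+k,k = ⊥-elim (a≮b (swap-reflects-< k lt not-1+k,k))

swap-⊓ : ∀ k a b → ¬ (a ≡ k × b ≡ suc k) → ¬ (a ≡ suc k × b ≡ k) → swap k (a ⊓ b) ≡ swap k a ⊓ swap k b
swap-⊓ k a b not-k,1+k not-1+k,k with <-cmp a b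
... | tri< a<b _ _ = trans (cong (swap k) (m≤n⇒m⊓n≡m (<⇒≤ a<b)))
                          (sym (m≤n⇒m⊓n≡m (<⇒≤ (swap-mono-< k a<b not-k,1+k))))
... | tri≈ _ refl _ = trans (cong (swap k) (⊓-idem a)) (sym (⊓-idem (swap k a)))
... | tri> _ _ b<a = trans (cong (swap k) (m≥n⇒m⊓n≡n (<⇒≤ b<a)))
                          (sym (m≥n⇒m⊓n≡n (<⇒≤ (swap-mono-< k b<a (λ (eb , ea) → not-1+k,k (ea , eb))))))

ind< : ℕ → ℕ → ℕ
ind< a b = if a <ᵇ b then 1 else 0

ind≡ : ℕ → ℕ → ℕ
ind≡ a b = if a ≡ᵇ b then 1 else 0

ind<-yes : ∀ {a b} → a < b → ind< a b ≡ 1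
ind<-yes {a} {b} a<b with a <ᵇ b | <⇒<ᵇ a<b
... | true | _ = refl

ind<-no : ∀ {a b} → ¬ a < b → ind< a b ≡ 0
ind<-no {a} {b} a≮b with a <ᵇ b | <ᵇ⇒< a b
... | true | a<b = ⊥-elim (a≮b (a<b tt))
... | false | _ = refl

ind<-irrefl : ∀ a → ind< a a ≡ 0
ind<-irrefl a = ind<-no (n≮n a)

ind<≤1 : ∀ a b → ind< a b ≤ 1
ind<≤1 a b with a <ᵇ b
... | true = ≤-refl
... | false = z≤n

ind<-monoʳ-≤ : ∀ c {a b} → a ≤ b → ind< c a ≤ ind< c b
ind<-monoʳ-≤ c {a} {b} a≤b with c <? a
... | yes c<a = ≤-reflexive (trans (ind<-yes c<a) (sym (ind<-yes (<-≤-trans c<a a≤b))))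
... | no c≮a = subst (_≤ ind< c b) (sym (ind<-no c≮a)) z≤n

ind<-swap : ∀ k a b → ¬ (a ≡ k × b ≡ suc k) → ¬ (a ≡ suc k × b ≡ k) → ind< (swap k a) (swap k b) ≡ ind< a b
ind<-swap k a b not-k,1+k not-1+k,k with a <? b
... | yes a<b = trans (ind<-yes (swap-mono-< k a<b not-k,1+k)) (sym (ind<-yes a<b))
... | no a≮b = trans (ind<-no (a≮b ∘ λ lt → swap-reflects-< k lt not-1+k,k)) (sym (ind<-no a≮b))

ind≡-refl : ∀ a → ind≡ a a ≡ 1
ind≡-refl a with a ≡ᵇ a | ≡⇒≡ᵇ a a refl
... | true | _ = refl

ind≡-no : ∀ {a b} → a ≢ b → ind≡ a b ≡ 0
ind≡-no {a} {b} a≢b with a ≡ᵇ b | ≡ᵇ⇒≡ a b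
... | true | a≡b = ⊥-elim (a≢b (a≡b tt))
... | false | _ = refl

ind≡-*-no : ∀ {i j p q} → ¬ (i ≡ p × j ≡ q) → ind≡ i p * ind≡ j q ≡ 0
ind≡-*-no {i} {j} {p} {q} not-p,q with i ≟ p
... | no i≢p = cong (_* ind≡ j q) (ind≡-no i≢p)
... | yes i≡p = trans (cong (ind≡ i p *_) (ind≡-no (λ j≡q → not-p,q (i≡p , j≡q)))) (*-zeroʳ (ind≡ i p))

act-++ : ∀ p q x → act (p ++ q) x ≡ act p (act q x)
act-++ [] q x = refl
act-++ (k ∷ p) q x = cong (swap k) (act-++ p q x)

act-injective : ∀ a → Injective (act a)
act-injective [] e = e
act-injective (k ∷ a) e = act-injective a (swap-injective k e)

act-reverse-act : ∀ a x → act (reverse a) (act a x) ≡ x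
act-reverse-act [] x = refl
act-reverse-act (k ∷ a) x = begin
  act (reverse (k ∷ a)) (swap k (act a x))    ≡⟨ cong (λ r → act r (swap k (act a x))) (unfold-reverse k a) ⟩
  act (reverse a ++ [ k ]) (swap k (act a x)) ≡⟨ act-++ (reverse a) [ k ] _ ⟩
  act (reverse a) (swap k (swap k (act a x))) ≡⟨ cong (act (reverse a)) (swap-involutive k (act a x)) ⟩
  act (reverse a) (act a x)                   ≡⟨ act-reverse-act a x ⟩
  x                                           ∎
  where open ≡-Reasoning

act-act-reverse : ∀ a x → act a (act (reverse a) x) ≡ x
act-act-reverse a x = act-injective (reverse a) (act-reverse-act a (act (reverse a) x))

WordBelow : ℕ → List ℕ → Set
WordBelow N = All (λ k → suc k < N)

act-fixes-above : ∀ {N} a {x} → WordBelow N a → N ≤ x → act a x ≡ x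
act-fixes-above [] _ _ = refl
act-fixes-above (k ∷ a) (k+1<N ∷ below) N≤x =
  trans (cong (swap k) (act-fixes-above a below N≤x)) (swap-fixes-above (<-≤-trans k+1<N N≤x))

wordBound : List ℕ → ℕ
wordBound [] = 0
wordBound (k ∷ b) = suc (suc k) ⊔ wordBound b

wordBelow-wordBound : ∀ {N} b → wordBound b ≤ N → WordBelow N b
wordBelow-wordBound [] _ = []
wordBelow-wordBound (k ∷ b) bound≤N =
  ≤-trans (m≤m⊔n (suc (suc k)) (wordBound b)) bound≤N ∷
  wordBelow-wordBound b (≤-trans (m≤n⊔m (suc (suc k)) (wordBound b)) bound≤N)

-- The deletion property; the hypothesis says that k is a right descent of act p.
deletion : ∀ p k → act p (suc k) < act p k →
  Σ (List ℕ) λ p' → suc (length p') ≡ length p × act p' ≐ act p ∘ swap k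
deletion [] k desc = ⊥-elim (<-asym desc (n<1+n k))
deletion (j ∷ p) k desc with <-cmp (act p (suc k)) (act p k)
... | tri< desc′ _ _ =
  let p' , len , eq = deletion p k desc′ in j ∷ p' , cong suc len , cong (swap j) ∘ eq
... | tri≈ _ e _ = ⊥-elim (1+n≢n (act-injective p e))
... | tri> ¬desc′ _ _ = p , refl , deleted
  where
  flipped : act p (suc k) ≡ suc j × act p k ≡ j
  flipped = swap-<-reversed j desc ¬desc′
  deleted : act p ≐ swap j ∘ act p ∘ swap k
  deleted x with swapView k x
  ... | at-k = trans (proj₂ flipped) (sym (begin
          swap j (act p (swap k k)) ≡⟨ cong (swap j ∘ act p) (swap-fst k) ⟩
          swap j (act p (suc k))    ≡⟨ cong (swap j) (proj₁ flipped) ⟩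
          swap j (suc j)            ≡⟨ swap-snd j ⟩
          j                         ∎))
    where open ≡-Reasoning
  ... | at-suc-k = trans (proj₁ flipped) (sym (begin
          swap j (act p (swap k (suc k))) ≡⟨ cong (swap j ∘ act p) (swap-snd k) ⟩
          swap j (act p k)                ≡⟨ cong (swap j) (proj₂ flipped) ⟩
          swap j j                        ≡⟨ swap-fst j ⟩
          suc j                           ∎))
    where open ≡-Reasoning
  ... | elsewhere x≢k x≢1+k =
    sym (trans (cong (swap j ∘ act p) (swap-other x≢k x≢1+k))
               (swap-other (x≢k ∘ act-injective p ∘ λ e → trans e (sym (proj₂ flipped)))
                           (x≢1+k ∘ act-injective p ∘ λ e → trans e (sym (proj₁ flipped)))))

-- AscentWord u a: every letter is a right ascent of the product of u with the letters before it,
-- i.e. u s_{a₁} ⋯ s_{aₘ} is a length-additive product.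
AscentWord : Fn → List ℕ → Set
AscentWord u [] = ⊤
AscentWord u (k ∷ a) = u k < u (suc k) × AscentWord (u ∘ swap k) a

ascentWord-cong : ∀ {u u'} a → u ≐ u' → AscentWord u a → AscentWord u' a
ascentWord-cong [] _ _ = tt
ascentWord-cong (k ∷ a) u≐u' (asc , rest) =
  subst₂ _<_ (u≐u' k) (u≐u' (suc k)) asc , ascentWord-cong a (u≐u' ∘ swap k) rest

ascentWord-++ : ∀ u b k → AscentWord u b → u (act b k) < u (act b (suc k)) → AscentWord u (b ++ [ k ])
ascentWord-++ u [] k _ asc = asc , tt
ascentWord-++ u (j ∷ b) k (ascj , rest) asc = ascj , ascentWord-++ (u ∘ swap j) b k rest asc

ascentWord-shortens : ∀ a u b → AscentWord u a → act b ≐ u ∘ act a →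
  Σ (List ℕ) λ b' → act b' ≐ u × length b' + length a ≤ length b
ascentWord-shortens [] u b _ b≐u = b , b≐u , ≤-reflexive (+-identityʳ (length b))
ascentWord-shortens (k ∷ a) u b (asc , rest) b≐uska
  with ascentWord-shortens a (u ∘ swap k) b rest b≐uska
... | b₁ , b₁≐usk , len₁
  with deletion b₁ k (subst₂ _<_ (sym (trans (b₁≐usk (suc k)) (cong u (swap-snd k))))
                                 (sym (trans (b₁≐usk k) (cong u (swap-fst k)))) asc)
...   | b₂ , len₂ , b₂≐b₁sk =
  b₂ , (λ x → trans (b₂≐b₁sk x) (trans (b₁≐usk (swap k x)) (cong u (swap-involutive k x)))) ,
  subst (_≤ length b) (trans (cong (_+ length a) (sym len₂)) (sym (+-suc (length b₂) (length a)))) len₁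

MinimalWord : List ℕ → Set
MinimalWord a = ∀ b → act b ≐ act a → length a ≤ length b

ascentWord⇒minimal : ∀ a → AscentWord (λ x → x) a → MinimalWord a
ascentWord⇒minimal a asc b b≐a =
  let b' , _ , len = ascentWord-shortens a (λ x → x) b asc b≐a
  in ≤-trans (m≤n+m (length a) (length b')) len

minimal⇒ascentWord : ∀ p a → MinimalWord (p ++ a) → AscentWord (act p) a
minimal⇒ascentWord p [] _ = tt
minimal⇒ascentWord p (k ∷ a) min with <-cmp (act p k) (act p (suc k))
... | tri< asc _ _ =
  asc , ascentWord-cong a (act-++ p [ k ]) (minimal⇒ascentWord (p ++ [ k ]) a min′)
  where
  min′ : MinimalWord ((p ++ [ k ]) ++ a)
  min′ b b≐ = subst (_≤ length b) (cong length (sym (++-assoc p [ k ] a)))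
                    (min b (λ x → trans (b≐ x) (cong (λ l → act l x) (++-assoc p [ k ] a))))
... | tri≈ _ e _ = ⊥-elim (n≢1+n k (act-injective p e))
... | tri> _ _ desc =
  let p' , len , p'≐psk = deletion p k desc
      shorter : length (p' ++ a) < length (p ++ k ∷ a)
      shorter = subst₂ _<_ (sym (length-++ p')) (sym (length-++ p))
                  (subst (λ n → length p' + length a < n + length (k ∷ a)) len
                     (s≤s (+-monoʳ-≤ (length p') (n≤1+n (length a)))))
      same : act (p' ++ a) ≐ act (p ++ k ∷ a)
      same x = trans (act-++ p' a x) (trans (p'≐psk (act a x)) (sym (act-++ p (k ∷ a) x)))
  in ⊥-elim (<⇒≱ shorter (min (p' ++ a) same))

reduced⇒ascentWord : ∀ {a w} → Reduced a w → AscentWord (λ x → x) a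
reduced⇒ascentWord {a} (rep , min) = minimal⇒ascentWord [] a (λ b b≐a → min b (λ i → trans (b≐a i) (rep i)))

reverse-minimal : ∀ a → MinimalWord a → MinimalWord (reverse a)
reverse-minimal a min d d≐ra =
  subst₂ _≤_ (sym (length-reverse a)) (length-reverse d) (min (reverse d) reverse-d≐a)
  where
  reverse-d≐a : act (reverse d) ≐ act a
  reverse-d≐a x = trans (cong (act (reverse d)) (sym (trans (d≐ra (act a x)) (act-reverse-act a x))))
                        (act-reverse-act d (act a x))

demStep-ascent : ∀ u k → u k < u (suc k) → demStep u k ≡ u ∘ swap k
demStep-ascent u k asc with u k <ᵇ u (suc k) | <⇒<ᵇ asc
... | true | _ = refl

demStep-descent : ∀ u k → ¬ u k < u (suc k) → demStep u k ≡ u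
demStep-descent u k ¬asc with u k <ᵇ u (suc k) | <ᵇ⇒< (u k) (u (suc k))
... | true | asc = ⊥-elim (¬asc (asc tt))
... | false | _ = refl

demStep-cong : ∀ {u u'} k → u ≐ u' → demStep u k ≐ demStep u' k
demStep-cong {u} {u'} k u≐u' x with u k <? u (suc k)
... | yes asc = begin
  demStep u k x     ≡⟨ cong-app (demStep-ascent u k asc) x ⟩
  u (swap k x)      ≡⟨ u≐u' (swap k x) ⟩
  u' (swap k x)     ≡⟨ cong-app (demStep-ascent u' k (subst₂ _<_ (u≐u' k) (u≐u' (suc k)) asc)) x ⟨
  demStep u' k x    ∎
  where open ≡-Reasoning
... | no ¬asc = begin
  demStep u k x     ≡⟨ cong-app (demStep-descent u k ¬asc) x ⟩
  u x               ≡⟨ u≐u' x ⟩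
  u' x              ≡⟨ cong-app (demStep-descent u' k (¬asc ∘ subst₂ _<_ (sym (u≐u' k)) (sym (u≐u' (suc k))))) x ⟨
  demStep u' k x    ∎
  where open ≡-Reasoning

foldl-demStep-cong : ∀ {u u'} b → u ≐ u' → foldl demStep u b ≐ foldl demStep u' b
foldl-demStep-cong [] u≐u' = u≐u'
foldl-demStep-cong (k ∷ b) u≐u' = foldl-demStep-cong b (demStep-cong k u≐u')

foldl-demStep-ascentWord : ∀ a u → AscentWord u a → foldl demStep u a ≐ u ∘ act a
foldl-demStep-ascentWord [] u _ x = refl
foldl-demStep-ascentWord (k ∷ a) u (asc , rest) x
  rewrite demStep-ascent u k asc = foldl-demStep-ascentWord a (u ∘ swap k) rest x

-- LeftDemStep k t t' says t' = s_k ∘ t, where p and q are the positions of k and k + 1 in t.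
LeftDemStep : ℕ → Fn → Fn → Set
LeftDemStep k t t' = Σ ℕ λ p → Σ ℕ λ q → t p ≡ k × t q ≡ suc k ×
  ((p < q × t' ≐ swap k ∘ t) ⊎ (q < p × t' ≐ t))

leftDemStep-injective : ∀ {k t t'} → Injective t → LeftDemStep k t t' → Injective t'
leftDemStep-injective {k} inj (_ , _ , _ , _ , inj₁ (_ , t'≐skt)) {x} {x'} e =
  inj (swap-injective k (trans (sym (t'≐skt x)) (trans e (t'≐skt x'))))
leftDemStep-injective inj (_ , _ , _ , _ , inj₂ (_ , t'≐t)) {x} {x'} e =
  inj (trans (sym (t'≐t x)) (trans e (t'≐t x')))

leftDemStep-cong : ∀ {k z z' t t'} → z ≐ z' → t ≐ t' → LeftDemStep k z t → LeftDemStep k z' t'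
leftDemStep-cong {k} z≐z' t≐t' (p , q , zp , zq , inj₁ (p<q , t≐skz)) =
  p , q , trans (sym (z≐z' p)) zp , trans (sym (z≐z' q)) zq ,
  inj₁ (p<q , λ x → trans (sym (t≐t' x)) (trans (t≐skz x) (cong (swap k) (z≐z' x))))
leftDemStep-cong z≐z' t≐t' (p , q , zp , zq , inj₂ (q<p , t≐z)) =
  p , q , trans (sym (z≐z' p)) zp , trans (sym (z≐z' q)) zq ,
  inj₂ (q<p , λ x → trans (sym (t≐t' x)) (trans (t≐z x) (z≐z' x)))

swap-intertwines : ∀ {t j k} → Injective t → t k ≡ j → t (suc k) ≡ suc j → swap j ∘ t ≐ t ∘ swap k
swap-intertwines {t} {j} {k} inj tk tk+1 x with swapView k x
... | at-k = trans (cong (swap j) tk) (trans (swap-fst j) (trans (sym tk+1) (cong t (sym (swap-fst k)))))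
... | at-suc-k = trans (cong (swap j) tk+1) (trans (swap-snd j) (trans (sym tk) (cong t (sym (swap-snd k)))))
... | elsewhere x≢k x≢1+k =
  trans (swap-other (x≢k ∘ inj ∘ λ e → trans e (sym tk)) (x≢1+k ∘ inj ∘ λ e → trans e (sym tk+1)))
        (cong t (sym (swap-other x≢k x≢1+k)))

private
  leftDemStep-≡ : ∀ {j t₁ t₂ u₁ u₂} → t₁ ≡ u₁ → t₂ ≡ u₂ → LeftDemStep j u₁ u₂ → LeftDemStep j t₁ t₂
  leftDemStep-≡ refl refl step = step

leftDemStep-demStep-absorbed : ∀ {j k t t' p q} → t p ≡ j → t q ≡ suc j → q < p → t' ≐ t →
  LeftDemStep j (demStep t k) (demStep t' k)
leftDemStep-demStep-absorbed {j} {k} {t} {t'} {p} {q} tp tq q<p t'≐t with t k <? t (suc k)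
... | yes asc = leftDemStep-≡ (demStep-ascent t k asc) (demStep-ascent t' k asc′)
      (swap k p , swap k q , trans (cong t (swap-involutive k p)) tp , trans (cong t (swap-involutive k q)) tq ,
       inj₂ (swap-mono-< k q<p not-k,1+k , t'≐t ∘ swap k))
  where
  asc′ : t' k < t' (suc k)
  asc′ = subst₂ _<_ (sym (t'≐t k)) (sym (t'≐t (suc k))) asc
  not-k,1+k : ¬ (q ≡ k × p ≡ suc k)
  not-k,1+k (refl , refl) = <-asym asc (subst₂ _<_ (sym tp) (sym tq) (n<1+n j))
... | no ¬asc = leftDemStep-≡ (demStep-descent t k ¬asc) (demStep-descent t' k (¬asc ∘ subst₂ _<_ (t'≐t k) (t'≐t (suc k))))
      (p , q , tp , tq , inj₂ (q<p , t'≐t))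

leftDemStep-demStep-applied : ∀ {j k t t' p q} → Injective t → t p ≡ j → t q ≡ suc j → p < q → t' ≐ swap j ∘ t →
  LeftDemStep j (demStep t k) (demStep t' k)
leftDemStep-demStep-applied {j} {k} {t} {t'} {p} {q} inj tp tq p<q t'≐sjt with <-cmp (t k) (t (suc k))
... | tri≈ _ e _ = ⊥-elim (n≢1+n k (inj e))
... | tri> _ _ desc = leftDemStep-≡ (demStep-descent t k (<-asym desc)) (demStep-descent t' k ¬asc′)
      (p , q , tp , tq , inj₁ (p<q , t'≐sjt))
  where
  ¬asc′ : ¬ t' k < t' (suc k)
  ¬asc′ asc′ = <-asym asc′ (subst₂ _<_ (sym (t'≐sjt (suc k))) (sym (t'≐sjt k))
    (swap-mono-< j desc λ (e₁ , e₂) →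
      <-asym (subst₂ _<_ (sym (inj (trans e₁ (sym tp)))) (sym (inj (trans e₂ (sym tq)))) p<q) (n<1+n k)))
... | tri< asc _ _ with p ≟ k ×-dec q ≟ suc k
...   | yes (refl , refl) = leftDemStep-≡ (demStep-ascent t k asc) (demStep-descent t' k ¬asc′)
        (suc k , p , trans (cong t (swap-snd p)) tp , trans (cong t (swap-fst p)) tq ,
         inj₂ (n<1+n p , λ x → trans (t'≐sjt x) (swap-intertwines inj tp tq x)))
  where
  ¬asc′ : ¬ t' p < t' (suc p)
  ¬asc′ asc′ = <-asym asc′ (subst₂ _<_ (sym (trans (t'≐sjt q) (trans (cong (swap j) tq) (swap-snd j))))
                                        (sym (trans (t'≐sjt p) (trans (cong (swap j) tp) (swap-fst j)))) (n<1+n j))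
...   | no not-k,1+k = leftDemStep-≡ (demStep-ascent t k asc) (demStep-ascent t' k asc′)
        (swap k p , swap k q , trans (cong t (swap-involutive k p)) tp , trans (cong t (swap-involutive k q)) tq ,
         inj₁ (swap-mono-< k p<q not-k,1+k , t'≐sjt ∘ swap k))
  where
  asc′ : t' k < t' (suc k)
  asc′ = subst₂ _<_ (sym (t'≐sjt k)) (sym (t'≐sjt (suc k))) (swap-mono-< j asc λ (e₁ , e₂) →
           not-k,1+k (sym (inj (trans e₁ (sym tp))) , sym (inj (trans e₂ (sym tq)))))

-- The associativity (s_j ∘ t) ∘ s_k = s_j ∘ (t ∘ s_k) of Demazure products.
leftDemStep-demStep : ∀ j k t t' → Injective t → LeftDemStep j t t' → LeftDemStep j (demStep t k) (demStep t' k)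
leftDemStep-demStep j k t t' inj (p , q , tp , tq , inj₁ (p<q , t'≐sjt)) = leftDemStep-demStep-applied inj tp tq p<q t'≐sjt
leftDemStep-demStep j k t t' inj (p , q , tp , tq , inj₂ (q<p , t'≐t)) = leftDemStep-demStep-absorbed tp tq q<p t'≐t

LeftDemChain : List ℕ → Fn → Fn → Set
LeftDemChain [] z u = z ≐ u
LeftDemChain (k ∷ r) z u = Σ Fn λ t → LeftDemStep k z t × LeftDemChain r t u

leftDemChain-congˡ : ∀ r {z z' u} → z ≐ z' → LeftDemChain r z u → LeftDemChain r z' u
leftDemChain-congˡ [] z≐z' z≐u x = trans (sym (z≐z' x)) (z≐u x)
leftDemChain-congˡ (k ∷ r) z≐z' (t , step , chain) = t , leftDemStep-cong z≐z' (λ _ → refl) step , chain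

leftDemChain-congʳ : ∀ r {z u u'} → u ≐ u' → LeftDemChain r z u → LeftDemChain r z u'
leftDemChain-congʳ [] u≐u' z≐u x = trans (z≐u x) (u≐u' x)
leftDemChain-congʳ (k ∷ r) u≐u' (t , step , chain) = t , step , leftDemChain-congʳ r u≐u' chain

leftDemChain-demStep : ∀ r k z u → Injective z → LeftDemChain r z u →
  LeftDemChain r (demStep z k) (demStep u k)
leftDemChain-demStep [] k z u _ z≐u = demStep-cong k z≐u
leftDemChain-demStep (j ∷ r) k z u inj (t , step , chain) =
  demStep t k , leftDemStep-demStep j k z t inj step ,
  leftDemChain-demStep r k t u (leftDemStep-injective inj step) chain

-- Demazure conjugation of involutions

FixesPair : Fn → ℕ → Set
FixesPair z k = z k ≡ k × z (suc k) ≡ suc k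

-- s_k ∘ z ∘ s_k for an involution z.
demConj : Fn → ℕ → Fn
demConj z k =
  if z k <ᵇ z (suc k)
  then (if (z k ≡ᵇ k) ∧ (z (suc k) ≡ᵇ suc k) then z ∘ swap k else swap k ∘ z ∘ swap k)
  else z

demConj-descent : ∀ z k → ¬ z k < z (suc k) → demConj z k ≡ z
demConj-descent z k ¬asc with z k <ᵇ z (suc k) | <ᵇ⇒< (z k) (z (suc k))
... | true | asc = ⊥-elim (¬asc (asc tt))
... | false | _ = refl

demConj-fixesPair : ∀ z k → z k < z (suc k) → FixesPair z k → demConj z k ≡ z ∘ swap k
demConj-fixesPair z k asc (fk , f1+k)
  with z k <ᵇ z (suc k) | <⇒<ᵇ asc | z k ≡ᵇ k | ≡⇒≡ᵇ (z k) k fk | z (suc k) ≡ᵇ suc k | ≡⇒≡ᵇ (z (suc k)) (suc k) f1+k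
... | true | _ | true | _ | true | _ = refl

demConj-movesPair : ∀ z k → z k < z (suc k) → ¬ FixesPair z k → demConj z k ≡ swap k ∘ z ∘ swap k
demConj-movesPair z k asc ¬fix
  with z k <ᵇ z (suc k) | <⇒<ᵇ asc | z k ≡ᵇ k | ≡ᵇ⇒≡ (z k) k | z (suc k) ≡ᵇ suc k | ≡ᵇ⇒≡ (z (suc k)) (suc k)
... | true | _ | true | fk | true | f1+k = ⊥-elim (¬fix (fk tt , f1+k tt))
... | true | _ | true | _ | false | _ = refl
... | true | _ | false | _ | _ | _ = refl

data DemConjView (z : Fn) (k : ℕ) : Set where
  descent : ¬ z k < z (suc k) → DemConjView z k
  fixed   : z k < z (suc k) → FixesPair z k → DemConjView z k
  moved   : z k < z (suc k) → ¬ FixesPair z k → DemConjView z k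

demConjView : ∀ z k → DemConjView z k
demConjView z k with z k <? z (suc k)
... | no ¬asc = descent ¬asc
... | yes asc with z k ≟ k ×-dec z (suc k) ≟ suc k
...   | yes fix = fixed asc fix
...   | no ¬fix = moved asc ¬fix

conj-involutive : ∀ z k → Involutive z → Involutive (swap k ∘ z ∘ swap k)
conj-involutive z k inv x =
  trans (cong (swap k ∘ z) (swap-involutive k (z (swap k x))))
        (trans (cong (swap k) (inv (swap k x))) (swap-involutive k x))

demConj-involutive : ∀ z k → Involutive z → Involutive (demConj z k)
demConj-involutive z k inv with demConjView z k
... | descent ¬asc rewrite demConj-descent z k ¬asc = inv
... | moved asc ¬fix rewrite demConj-movesPair z k asc ¬fix = conj-involutive z k inv
... | fixed asc fix rewrite demConj-fixesPair z k asc fix = λ x →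
  trans (cong (z ∘ swap k) (sym (swap-intertwines {z} {k} {k} (involutive⇒injective inv) (proj₁ fix) (proj₂ fix) x)))
        (trans (cong z (swap-involutive k (z x))) (inv x))

demConj-cong : ∀ {u v} k → u ≐ v → demConj u k ≐ demConj v k
demConj-cong {u} {v} k u≐v x with demConjView u k
... | descent ¬asc =
  trans (cong-app (demConj-descent u k ¬asc) x)
        (trans (u≐v x) (sym (cong-app (demConj-descent v k (¬asc ∘ subst₂ _<_ (sym (u≐v k)) (sym (u≐v (suc k))))) x)))
... | fixed asc (fk , f1+k) =
  trans (cong-app (demConj-fixesPair u k asc (fk , f1+k)) x)
        (trans (u≐v (swap k x))
               (sym (cong-app (demConj-fixesPair v k (subst₂ _<_ (u≐v k) (u≐v (suc k)) asc)
                                                 (trans (sym (u≐v k)) fk , trans (sym (u≐v (suc k))) f1+k)) x)))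
... | moved asc ¬fix =
  trans (cong-app (demConj-movesPair u k asc ¬fix) x)
        (trans (cong (swap k) (u≐v (swap k x)))
               (sym (cong-app (demConj-movesPair v k (subst₂ _<_ (u≐v k) (u≐v (suc k)) asc)
                                                 (λ (fk , f1+k) → ¬fix (trans (u≐v k) fk , trans (u≐v (suc k)) f1+k))) x)))

leftDemStep-involution : ∀ {k z t} → Involutive z → LeftDemStep k z t →
  (z k < z (suc k) × t ≐ swap k ∘ z) ⊎ (z (suc k) < z k × t ≐ z)
leftDemStep-involution {z = z} inv (p , q , zp , zq , order) with order
... | inj₁ (p<q , t≐skz) = inj₁ (subst₂ _<_ p≡zk q≡z1+k p<q , t≐skz)
  where
  p≡zk : p ≡ z _
  p≡zk = trans (sym (inv p)) (cong z zp)
  q≡z1+k : q ≡ z _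
  q≡z1+k = trans (sym (inv q)) (cong z zq)
... | inj₂ (q<p , t≐z) = inj₂ (subst₂ _<_ q≡z1+k p≡zk q<p , t≐z)
  where
  p≡zk : p ≡ z _
  p≡zk = trans (sym (inv p)) (cong z zp)
  q≡z1+k : q ≡ z _
  q≡z1+k = trans (sym (inv q)) (cong z zq)

demStep-leftDemStep : ∀ k z t → Involutive z → LeftDemStep k z t → demStep t k ≐ demConj z k
demStep-leftDemStep k z t inv step x with demConjView z k | leftDemStep-involution inv step
... | descent ¬asc | inj₂ (_ , t≐z) =
  trans (cong-app (demStep-descent t k (¬asc ∘ subst₂ _<_ (t≐z k) (t≐z (suc k)))) x)
        (trans (t≐z x) (sym (cong-app (demConj-descent z k ¬asc) x)))
... | descent ¬asc | inj₁ (asc , _) = ⊥-elim (¬asc asc)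
... | fixed asc _ | inj₂ (desc , _) = ⊥-elim (<-asym asc desc)
... | moved asc _ | inj₂ (desc , _) = ⊥-elim (<-asym asc desc)
... | fixed asc (fk , f1+k) | inj₁ (_ , t≐skz) = begin
  demStep t k x   ≡⟨ cong-app (demStep-descent t k ¬asc′) x ⟩
  t x             ≡⟨ t≐skz x ⟩
  swap k (z x)    ≡⟨ swap-intertwines {z} {k} {k} (involutive⇒injective inv) fk f1+k x ⟩
  z (swap k x)    ≡⟨ cong-app (demConj-fixesPair z k asc (fk , f1+k)) x ⟨
  demConj z k x   ∎
  where
  open ≡-Reasoning
  ¬asc′ : ¬ t k < t (suc k)
  ¬asc′ asc′ = <-asym asc′ (subst₂ _<_ (sym (trans (t≐skz (suc k)) (trans (cong (swap k) f1+k) (swap-snd k))))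
                                       (sym (trans (t≐skz k) (trans (cong (swap k) fk) (swap-fst k)))) (n<1+n k))
... | moved asc ¬fix | inj₁ (_ , t≐skz) = begin
  demStep t k x            ≡⟨ cong-app (demStep-ascent t k asc′) x ⟩
  t (swap k x)             ≡⟨ t≐skz (swap k x) ⟩
  swap k (z (swap k x))    ≡⟨ cong-app (demConj-movesPair z k asc ¬fix) x ⟨
  demConj z k x            ∎
  where
  open ≡-Reasoning
  asc′ : t k < t (suc k)
  asc′ = subst₂ _<_ (sym (t≐skz k)) (sym (t≐skz (suc k))) (swap-mono-< k asc ¬fix)

foldl-demStep-leftDemChain : ∀ r z u → Involutive z → LeftDemChain r z u → foldl demStep u r ≐ foldl demConj z r
foldl-demStep-leftDemChain [] z u _ z≐u x = sym (z≐u x)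
foldl-demStep-leftDemChain (k ∷ r) z u inv (t , step , chain) =
  foldl-demStep-leftDemChain r (demConj z k) (demStep u k) (demConj-involutive z k inv)
    (leftDemChain-congˡ r (demStep-leftDemStep k z t inv step)
      (leftDemChain-demStep r k t u (leftDemStep-injective (involutive⇒injective inv) step) chain))

leftDemChain-ascentWord : ∀ b u h → AscentWord u b → (∀ x → h (u x) ≡ x) → (∀ x → u (h x) ≡ x) →
  Σ Fn λ h' → LeftDemChain b h h' × (∀ x → h' (u (act b x)) ≡ x)
leftDemChain-ascentWord [] u h _ hu≐id _ = h , (λ _ → refl) , hu≐id
leftDemChain-ascentWord (k ∷ b) u h (asc , rest) hu≐id uh≐id
  with leftDemChain-ascentWord b (u ∘ swap k) (swap k ∘ h) rest
         (λ x → trans (cong (swap k) (hu≐id (swap k x))) (swap-involutive k x))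
         (λ x → trans (cong u (swap-involutive k (h x))) (uh≐id x))
... | h' , chain , h'≐inv =
  h' , (swap k ∘ h , (u k , u (suc k) , hu≐id k , hu≐id (suc k) , inj₁ (asc , λ _ → refl)) , chain) , h'≐inv

-- In w⁻¹ ∘ s_{b₁} ∘ ⋯ ∘ s_{bₘ}, write w⁻¹ = s_{bₘ} ⋯ s_{b₁} and regroup by associativity: each letter
-- then acts by Demazure conjugation.
demazure-inverse : ∀ a b {g w} → Reduced a g → Reduced b w → IsInverse g w →
  dem (a ++ b) ≐ foldl demConj (λ x → x) b
demazure-inverse a b {g} {w} ra rb (_ , wg) i = begin
  dem (a ++ b) i                              ≡⟨ cong-app (foldl-++ demStep (λ x → x) a b) i ⟩
  foldl demStep (foldl demStep id a) b i      ≡⟨ foldl-demStep-cong b (λ x → trans (foldl-demStep-ascentWord a id (reduced⇒ascentWord ra) x) (proj₁ ra x)) i ⟩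
  foldl demStep g b i                         ≡⟨ foldl-demStep-leftDemChain b id g (λ _ → refl) chain i ⟩
  foldl demConj id b i                        ∎
  where
  open ≡-Reasoning
  id : Fn
  id x = x
  built : Σ Fn λ h' → LeftDemChain b id h' × (∀ x → h' (act b x) ≡ x)
  built = leftDemChain-ascentWord b id id (reduced⇒ascentWord rb) (λ _ → refl) (λ _ → refl)
  built≐g : proj₁ built ≐ g
  built≐g x = trans (cong (proj₁ built) (sym (trans (proj₁ rb (g x)) (wg x)))) (proj₂ (proj₂ built) (g x))
  chain : LeftDemChain b id g
  chain = leftDemChain-congʳ b built≐g (proj₁ (proj₂ built))

sum< : ℕ → (ℕ → ℕ) → ℕ
sum< zero f = 0
sum< (suc n) f = sum< n f + f n

sum<-cong : ∀ n {f g} → (∀ i → i < n → f i ≡ g i) → sum< n f ≡ sum< n g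
sum<-cong zero _ = refl
sum<-cong (suc n) f≡g = cong₂ _+_ (sum<-cong n (λ i i<n → f≡g i (<-trans i<n (n<1+n n)))) (f≡g n (n<1+n n))

sum<-mono-≤ : ∀ n {f g} → (∀ i → i < n → f i ≤ g i) → sum< n f ≤ sum< n g
sum<-mono-≤ zero _ = z≤n
sum<-mono-≤ (suc n) f≤g = +-mono-≤ (sum<-mono-≤ n (λ i i<n → f≤g i (<-trans i<n (n<1+n n)))) (f≤g n (n<1+n n))

sum<-+ : ∀ n f g → sum< n (λ i → f i + g i) ≡ sum< n f + sum< n g
sum<-+ zero f g = refl
sum<-+ (suc n) f g rewrite sum<-+ n f g = +-interchange (sum< n f) (sum< n g) (f n) (g n)

sum<-*ˡ : ∀ n c f → sum< n (λ i → c * f i) ≡ c * sum< n f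
sum<-*ˡ zero c f = sym (*-zeroʳ c)
sum<-*ˡ (suc n) c f rewrite sum<-*ˡ n c f = sym (*-distribˡ-+ c (sum< n f) (f n))

sum<-const : ∀ n c → sum< n (λ _ → c) ≡ n * c
sum<-const zero c = refl
sum<-const (suc n) c = trans (cong (_+ c) (sum<-const n c)) (+-comm (n * c) c)

sum<-swap : ∀ n k f → suc k < n → sum< n (f ∘ swap k) ≡ sum< n f
sum<-swap (suc n) k f k+1<1+n with suc k ≟ n
... | no k+1≢n = cong₂ _+_ (sum<-swap n k f k+1<n) (cong f (swap-fixes-above k+1<n))
  where
  k+1<n : suc k < n
  k+1<n = ≤∧≢⇒< (≤-pred k+1<1+n) k+1≢n
... | yes refl = begin
  sum< k (f ∘ swap k) + f (swap k k) + f (swap k (suc k)) ≡⟨ cong₂ (λ a b → a + b + f (swap k (suc k)))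
                                                              (sum<-cong k (λ i i<k → cong f (below i<k))) (cong f (swap-fst k)) ⟩
  sum< k f + f (suc k) + f (swap k (suc k))               ≡⟨ cong (sum< k f + f (suc k) +_) (cong f (swap-snd k)) ⟩
  sum< k f + f (suc k) + f k                              ≡⟨ +-assoc (sum< k f) (f (suc k)) (f k) ⟩
  sum< k f + (f (suc k) + f k)                            ≡⟨ cong (sum< k f +_) (+-comm (f (suc k)) (f k)) ⟩
  sum< k f + (f k + f (suc k))                            ≡⟨ +-assoc (sum< k f) (f k) (f (suc k)) ⟨
  sum< k f + f k + f (suc k)                              ∎
  where
  open ≡-Reasoning
  below : ∀ {i} → i < k → swap k i ≡ i
  below i<k = swap-other (<⇒≢ i<k) (<⇒≢ (<-trans i<k (n<1+n k)))

sum<-act : ∀ n b f → WordBelow n b → sum< n (f ∘ act b) ≡ sum< n f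
sum<-act n [] f _ = refl
sum<-act n (k ∷ b) f (k+1<n ∷ below) = trans (sum<-act n b (f ∘ swap k) below) (sum<-swap n k f k+1<n)

sum<-ind≡ : ∀ n p → p < n → sum< n (λ i → ind≡ i p) ≡ 1
sum<-ind≡ (suc n) p p<1+n with p ≟ n
... | yes refl = trans (cong₂ _+_ (trans (sum<-cong p (λ i i<p → ind≡-no (<⇒≢ i<p))) (sum<-const p 0)) (ind≡-refl p))
                       (cong (_+ 1) (*-zeroʳ p))
... | no p≢n = cong₂ _+_ (sum<-ind≡ n p (≤∧≢⇒< (≤-pred p<1+n) p≢n)) (ind≡-no (p≢n ∘ sym))

sum<-ind< : ∀ n t → sum< n (λ i → ind< i t) ≡ n ⊓ t
sum<-ind< zero t = refl
sum<-ind< (suc n) t with <-cmp n t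
... | tri< n<t _ _ = begin
  sum< n (λ i → ind< i t) + ind< n t ≡⟨ cong₂ _+_ (sum<-ind< n t) (ind<-yes n<t) ⟩
  n ⊓ t + 1                          ≡⟨ cong (_+ 1) (m≤n⇒m⊓n≡m (<⇒≤ n<t)) ⟩
  n + 1                              ≡⟨ +-comm n 1 ⟩
  suc n                              ≡⟨ m≤n⇒m⊓n≡m n<t ⟨
  suc n ⊓ t                          ∎
  where open ≡-Reasoning
... | tri≈ _ refl _ = begin
  sum< n (λ i → ind< i n) + ind< n n ≡⟨ cong₂ _+_ (sum<-ind< n n) (ind<-irrefl n) ⟩
  n ⊓ n + 0                          ≡⟨ +-identityʳ (n ⊓ n) ⟩
  n ⊓ n                              ≡⟨ ⊓-idem n ⟩
  n                                  ≡⟨ m≥n⇒m⊓n≡n (n≤1+n n) ⟨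
  suc n ⊓ n                          ∎
  where open ≡-Reasoning
... | tri> _ _ t<n = begin
  sum< n (λ i → ind< i t) + ind< n t ≡⟨ cong₂ _+_ (sum<-ind< n t) (ind<-no (<-asym t<n)) ⟩
  n ⊓ t + 0                          ≡⟨ +-identityʳ (n ⊓ t) ⟩
  n ⊓ t                              ≡⟨ m≥n⇒m⊓n≡n (<⇒≤ t<n) ⟩
  t                                  ≡⟨ m≥n⇒m⊓n≡n (≤-trans (<⇒≤ t<n) (n≤1+n n)) ⟨
  suc n ⊓ t                          ∎
  where open ≡-Reasoning

sum<² : ℕ → (ℕ → ℕ → ℕ) → ℕ
sum<² n F = sum< n (λ i → sum< n (F i))

sum<²-cong : ∀ n {F G} → (∀ i j → F i j ≡ G i j) → sum<² n F ≡ sum<² n G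
sum<²-cong n F≡G = sum<-cong n (λ i _ → sum<-cong n (λ j _ → F≡G i j))

sum<²-+ : ∀ n F G → sum<² n (λ i j → F i j + G i j) ≡ sum<² n F + sum<² n G
sum<²-+ n F G = trans (sum<-cong n (λ i _ → sum<-+ n (F i) (G i))) (sum<-+ n _ _)

sum<²-swap : ∀ n k F → suc k < n → sum<² n (λ i j → F (swap k i) (swap k j)) ≡ sum<² n F
sum<²-swap n k F k+1<n =
  trans (sum<-cong n (λ i _ → sum<-swap n k (F (swap k i)) k+1<n)) (sum<-swap n k (λ i → sum< n (F i)) k+1<n)

sum<²-ind≡ : ∀ n p q → p < n → q < n → sum<² n (λ i j → ind≡ i p * ind≡ j q) ≡ 1
sum<²-ind≡ n p q p<n q<n =
  trans (sum<-cong n (λ i _ → trans (sum<-*ˡ n (ind≡ i p) (λ j → ind≡ j q))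
                                   (trans (cong (ind≡ i p *_) (sum<-ind≡ n q q<n)) (*-identityʳ _))))
        (sum<-ind≡ n p p<n)

-- The weight ℓ + κ of an involution

inversions : ℕ → Fn → ℕ
inversions N u = sum<² N (λ i j → ind< i j * ind< (u j) (u i))

excedances : ℕ → Fn → ℕ
excedances N u = sum< N (λ x → ind< x (u x))

-- ℓ(z) + κ(z), where κ(z) counts the 2-cycles of the involution z: twice its involution length.
weight : ℕ → Fn → ℕ
weight N u = inversions N u + excedances N u

weight-cong : ∀ N {u v} → u ≐ v → weight N u ≡ weight N v
weight-cong N u≐v = cong₂ _+_ (sum<²-cong N (λ i j → cong₂ (λ a b → ind< i j * ind< a b) (u≐v j) (u≐v i)))
                               (sum<-cong N (λ x _ → cong (ind< x) (u≐v x)))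

inversions-ascentʳ : ∀ N k u → suc k < N → u k < u (suc k) → inversions N (u ∘ swap k) ≡ suc (inversions N u)
inversions-ascentʳ N k u k+1<N asc = begin
  inversions N (u ∘ swap k)
    ≡⟨ sum<²-swap N k (λ i j → ind< i j * ind< (u (swap k j)) (u (swap k i))) k+1<N ⟨
  sum<² N (λ i j → ind< (swap k i) (swap k j) * ind< (u (swap k (swap k j))) (u (swap k (swap k i))))
    ≡⟨ sum<²-cong N (λ i j → trans (cong₂ (λ a b → ind< (swap k i) (swap k j) * ind< (u a) (u b))
                                          (swap-involutive k j) (swap-involutive k i)) (pointwise i j)) ⟩
  sum<² N (λ i j → ind< i j * ind< (u j) (u i) + ind≡ i (suc k) * ind≡ j k)
    ≡⟨ sum<²-+ N _ _ ⟩
  inversions N u + sum<² N (λ i j → ind≡ i (suc k) * ind≡ j k)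
    ≡⟨ cong (inversions N u +_) (sum<²-ind≡ N (suc k) k k+1<N (<-trans (n<1+n k) k+1<N)) ⟩
  inversions N u + 1
    ≡⟨ +-comm _ 1 ⟩
  suc (inversions N u) ∎
  where
  open ≡-Reasoning
  pointwise : ∀ i j → ind< (swap k i) (swap k j) * ind< (u j) (u i) ≡ ind< i j * ind< (u j) (u i) + ind≡ i (suc k) * ind≡ j k
  pointwise i j with i ≟ suc k ×-dec j ≟ k | i ≟ k ×-dec j ≟ suc k
  ... | yes (refl , refl) | _
    rewrite swap-snd k | swap-fst k | ind<-yes asc | ind<-yes (n<1+n k) | ind<-no (<-asym (n<1+n k)) | ind≡-refl k = refl
  ... | no _ | yes (refl , refl)
    rewrite swap-snd k | swap-fst k | ind<-yes (n<1+n k) | ind<-no (<-asym (n<1+n k)) | ind<-no (<-asym asc)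
          | ind≡-no (n≢1+n k) = refl
  ... | no not-1+k,k | no not-k,1+k =
    trans (cong (_* ind< (u j) (u i)) (ind<-swap k i j not-k,1+k not-1+k,k))
          (sym (trans (cong (ind< i j * ind< (u j) (u i) +_) (ind≡-*-no not-1+k,k)) (+-identityʳ _)))

inversions-ascentˡ : ∀ N k t → Injective t → ∀ {p q} → t p ≡ k → t q ≡ suc k → p < q → p < N → q < N →
  inversions N (swap k ∘ t) ≡ suc (inversions N t)
inversions-ascentˡ N k t inj {p} {q} tp tq p<q p<N q<N = begin
  inversions N (swap k ∘ t)                                 ≡⟨ sum<²-cong N pointwise ⟩
  sum<² N (λ i j → ind< i j * ind< (t j) (t i) + ind≡ i p * ind≡ j q) ≡⟨ sum<²-+ N _ _ ⟩
  inversions N t + sum<² N (λ i j → ind≡ i p * ind≡ j q)    ≡⟨ cong (inversions N t +_) (sum<²-ind≡ N p q p<N q<N) ⟩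
  inversions N t + 1                                        ≡⟨ +-comm _ 1 ⟩
  suc (inversions N t)                                      ∎
  where
  open ≡-Reasoning
  pointwise : ∀ i j → ind< i j * ind< (swap k (t j)) (swap k (t i)) ≡ ind< i j * ind< (t j) (t i) + ind≡ i p * ind≡ j q
  pointwise i j with i ≟ p ×-dec j ≟ q | i ≟ q ×-dec j ≟ p
  ... | yes (refl , refl) | _
    rewrite tp | tq | swap-snd k | swap-fst k | ind<-yes p<q | ind<-yes (n<1+n k) | ind<-no (<-asym (n<1+n k))
          | ind≡-refl i | ind≡-refl j = refl
  ... | no _ | yes (refl , refl) rewrite ind<-no (<-asym p<q) | ind≡-no (<⇒≢ p<q ∘ sym) = refl
  ... | no not-p,q | no not-q,p =
    trans (cong (ind< i j *_) (ind<-swap k (t j) (t i)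
                                (λ (e₁ , e₂) → not-q,p (inj (trans e₂ (sym tq)) , inj (trans e₁ (sym tp))))
                                (λ (e₁ , e₂) → not-p,q (inj (trans e₂ (sym tp)) , inj (trans e₁ (sym tq))))))
          (sym (trans (cong (ind< i j * ind< (t j) (t i) +_) (ind≡-*-no not-p,q)) (+-identityʳ _)))

excedances-conj : ∀ N k z → suc k < N → Involutive z → z k ≢ suc k →
  excedances N (swap k ∘ z ∘ swap k) ≡ excedances N z
excedances-conj N k z k+1<N inv zk≢1+k =
  trans (sym (sum<-swap N k (λ x → ind< x (swap k (z (swap k x)))) k+1<N))
        (sum<-cong N (λ x _ → trans (cong (λ v → ind< (swap k x) (swap k (z v))) (swap-involutive k x))
          (ind<-swap k x (z x) (λ { (refl , e) → zk≢1+k e })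
                               (λ { (refl , e) → zk≢1+k (trans (cong z (sym e)) (inv (suc k))) }))))

excedances-fixesPair : ∀ N k z → suc k < N → FixesPair z k → excedances N (z ∘ swap k) ≡ suc (excedances N z)
excedances-fixesPair N k z k+1<N (fk , f1+k) =
  trans (sum<-cong N (λ x _ → pointwise x))
        (trans (sum<-+ N _ _)
               (trans (cong (excedances N z +_) (sum<-ind≡ N k (<-trans (n<1+n k) k+1<N))) (+-comm _ 1)))
  where
  pointwise : ∀ x → ind< x (z (swap k x)) ≡ ind< x (z x) + ind≡ x k
  pointwise x with swapView k x
  ... | at-k rewrite swap-fst k | fk | f1+k | ind≡-refl k | ind<-yes (n<1+n k) | ind<-irrefl k = refl
  ... | at-suc-k rewrite swap-snd k | fk | f1+k | ind<-no (<-asym (n<1+n k)) | ind<-irrefl (suc k)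
                       | ind≡-no (n≢1+n k ∘ sym) = refl
  ... | elsewhere x≢k x≢1+k rewrite swap-other x≢k x≢1+k | ind≡-no x≢k = sym (+-identityʳ _)

FixesAbove : ℕ → Fn → Set
FixesAbove N z = ∀ x → N ≤ x → z x ≡ x

involution-bounded : ∀ {N z} → Involutive z → FixesAbove N z → ∀ {x} → x < N → z x < N
involution-bounded {N} {z} inv above {x} x<N with <-cmp (z x) N
... | tri< zx<N _ _ = zx<N
... | tri≈ _ zx≡N _ = ⊥-elim (<⇒≢ x<N (trans (sym (inv x)) (trans (above (z x) (≤-reflexive (sym zx≡N))) zx≡N)))
... | tri> _ _ N<zx = ⊥-elim (<⇒≱ x<N (subst (N ≤_) (trans (sym (above (z x) (<⇒≤ N<zx))) (inv x)) (<⇒≤ N<zx)))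

weight-demConj-ascent : ∀ N k z → Involutive z → FixesAbove N z → suc k < N → z k < z (suc k) →
  weight N (demConj z k) ≡ 2 + weight N z
weight-demConj-ascent N k z inv above k+1<N asc with demConjView z k
... | descent ¬asc = ⊥-elim (¬asc asc)
... | fixed _ fix rewrite demConj-fixesPair z k asc fix | inversions-ascentʳ N k z k+1<N asc
                        | excedances-fixesPair N k z k+1<N fix = cong suc (+-suc _ _)
... | moved _ ¬fix rewrite demConj-movesPair z k asc ¬fix =
  cong₂ _+_ (trans (inversions-ascentˡ N k (z ∘ swap k) (swap-injective k ∘ involutive⇒injective {z} inv)
                     (trans (cong z (swap-involutive k (z k))) (inv k))
                     (trans (cong z (swap-involutive k (z (suc k)))) (inv (suc k)))
                     (swap-mono-< k asc ¬fix)
                     (swap-bounded k+1<N (involution-bounded inv above (<-trans (n<1+n k) k+1<N)))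
                     (swap-bounded k+1<N (involution-bounded inv above k+1<N)))
                   (cong suc (inversions-ascentʳ N k z k+1<N asc)))
            (excedances-conj N k z k+1<N inv zk≢1+k)
  where
  zk≢1+k : z k ≢ suc k
  zk≢1+k zk≡1+k = <-asym asc (subst₂ _<_ (sym (trans (cong z (sym zk≡1+k)) (inv k))) (sym zk≡1+k) (n<1+n k))

demConj-fixesAbove : ∀ N k z → FixesAbove N z → suc k < N → FixesAbove N (demConj z k)
demConj-fixesAbove N k z above k+1<N x N≤x with demConjView z k
... | descent ¬asc rewrite demConj-descent z k ¬asc = above x N≤x
... | fixed asc fix rewrite demConj-fixesPair z k asc fix | swap-fixes-above (<-≤-trans k+1<N N≤x) = above x N≤x
... | moved asc ¬fix rewrite demConj-movesPair z k asc ¬fix | swap-fixes-above (<-≤-trans k+1<N N≤x)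
                           | above x N≤x = swap-fixes-above (<-≤-trans k+1<N N≤x)

ascentCount : Fn → List ℕ → ℕ
ascentCount z [] = 0
ascentCount z (k ∷ b) = ind< (z k) (z (suc k)) + ascentCount (demConj z k) b

AllAscents : Fn → List ℕ → Set
AllAscents z [] = ⊤
AllAscents z (k ∷ b) = z k < z (suc k) × AllAscents (demConj z k) b

allAscents-++ : ∀ z b k → AllAscents z b → foldl demConj z b k < foldl demConj z b (suc k) →
  AllAscents z (b ++ [ k ])
allAscents-++ z [] k _ asc = asc , tt
allAscents-++ z (j ∷ b) k (ascj , rest) asc = ascj , allAscents-++ (demConj z j) b k rest asc

weight-foldl-demConj : ∀ N b z → Involutive z → FixesAbove N z → WordBelow N b →
  weight N (foldl demConj z b) ≡ 2 * ascentCount z b + weight N z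
weight-foldl-demConj N [] z _ _ _ = refl
weight-foldl-demConj N (k ∷ b) z inv above (k+1<N ∷ below)
  rewrite weight-foldl-demConj N b (demConj z k) (demConj-involutive z k inv) (demConj-fixesAbove N k z above k+1<N) below
  with z k <? z (suc k)
... | yes asc rewrite ind<-yes asc | weight-demConj-ascent N k z inv above k+1<N asc = begin
  2 * ascentCount (demConj z k) b + (2 + weight N z)   ≡⟨ +-assoc (2 * ascentCount (demConj z k) b) 2 (weight N z) ⟨
  2 * ascentCount (demConj z k) b + 2 + weight N z     ≡⟨ cong (_+ weight N z) (+-comm (2 * ascentCount (demConj z k) b) 2) ⟩
  2 + 2 * ascentCount (demConj z k) b + weight N z     ≡⟨ cong (_+ weight N z) (*-distribˡ-+ 2 1 (ascentCount (demConj z k) b)) ⟨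
  2 * (1 + ascentCount (demConj z k) b) + weight N z   ∎
  where open ≡-Reasoning
... | no ¬asc rewrite ind<-no ¬asc | demConj-descent z k ¬asc = refl

ascentCount≤length : ∀ z b → ascentCount z b ≤ length b
ascentCount≤length z [] = z≤n
ascentCount≤length z (k ∷ b) = +-mono-≤ (ind<≤1 (z k) (z (suc k))) (ascentCount≤length (demConj z k) b)

ascentCount≥length⇒allAscents : ∀ z b → length b ≤ ascentCount z b → AllAscents z b
ascentCount≥length⇒allAscents z [] _ = tt
ascentCount≥length⇒allAscents z (k ∷ b) len≤ with z k <? z (suc k)
... | yes asc rewrite ind<-yes asc = asc , ascentCount≥length⇒allAscents (demConj z k) b (≤-pred len≤)
... | no ¬asc rewrite ind<-no ¬asc = ⊥-elim (<⇒≱ (s≤s (ascentCount≤length (demConj z k) b)) len≤)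

allAscents⇒ascentCount≡length : ∀ z b → AllAscents z b → ascentCount z b ≡ length b
allAscents⇒ascentCount≡length z [] _ = refl
allAscents⇒ascentCount≡length z (k ∷ b) (asc , rest) rewrite ind<-yes asc =
  cong suc (allAscents⇒ascentCount≡length (demConj z k) b rest)

sum<-+-≤ : ∀ n {f g h} → (∀ i → f i + g i ≤ h i) → sum< n f + sum< n g ≤ sum< n h
sum<-+-≤ n {f} {g} f+g≤h = subst (_≤ _) (sum<-+ n f g) (sum<-mono-≤ n (λ i _ → f+g≤h i))

-- The canonical atom

blockMin : Fn → ℕ → ℕ
blockMin y x = x ⊓ y x

blockMin-involution : ∀ {y} → Involutive y → ∀ x → blockMin y (y x) ≡ blockMin y x
blockMin-involution {y} inv x = trans (cong (y x ⊓_) (inv x)) (⊓-comm (y x) x)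

same-block : ∀ {y} → Involutive y → ∀ {x k} → blockMin y x ≡ blockMin y k → x ≡ k ⊎ x ≡ y k
same-block {y} inv {x} {k} e with ⊓-sel x (y x) | ⊓-sel k (y k)
... | inj₁ mx | inj₁ mk = inj₁ (trans (sym mx) (trans e mk))
... | inj₁ mx | inj₂ mk = inj₂ (trans (sym mx) (trans e mk))
... | inj₂ mx | inj₁ mk = inj₂ (trans (sym (inv x)) (cong y (trans (sym mx) (trans e mk))))
... | inj₂ mx | inj₂ mk = inj₁ (trans (sym (inv x)) (trans (cong y (trans (sym mx) (trans e mk))) (inv k)))

-- Our candidate for α_min(y): points below N are ranked by the minimum of their y-cycle, the larger
-- point of a 2-cycle first; points from N on are fixed.
canonical : Fn → ℕ → Fn
canonical y N x = sum< N (λ z → ind< (blockMin y z) (blockMin y x)) + ind< x (y x) + (x ∸ N)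

module Canonical (y : Fn) (N : ℕ) (inv : Involutive y) (above : FixesAbove N y) where

  rank : ℕ → ℕ
  rank x = sum< N (λ z → ind< (blockMin y z) (blockMin y x))

  canonical-below : ∀ {x} → x < N → canonical y N x ≡ rank x + ind< x (y x)
  canonical-below {x} x<N = trans (cong (rank x + ind< x (y x) +_) (m≤n⇒m∸n≡0 (<⇒≤ x<N))) (+-identityʳ _)

  moved-below : ∀ {x} → y x ≢ x → x < N
  moved-below {x} yx≢x = ≰⇒> (yx≢x ∘ above x)

  canonical-fixesAbove : FixesAbove N (canonical y N)
  canonical-fixesAbove x N≤x rewrite above x N≤x | ⊓-idem x = begin
    rank′ + ind< x x + (x ∸ N) ≡⟨ cong₂ (λ a b → a + b + (x ∸ N)) rank′≡N (ind<-irrefl x) ⟩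
    N + 0 + (x ∸ N)            ≡⟨ cong (_+ (x ∸ N)) (+-identityʳ N) ⟩
    N + (x ∸ N)                ≡⟨ m+[n∸m]≡n N≤x ⟩
    x                          ∎
    where
    open ≡-Reasoning
    rank′ : ℕ
    rank′ = sum< N (λ z → ind< (blockMin y z) x)
    rank′≡N : rank′ ≡ N
    rank′≡N = trans (sum<-cong N (λ z z<N → ind<-yes (<-≤-trans (≤-<-trans (m⊓n≤m z (y z)) z<N) N≤x)))
                    (trans (sum<-const N 1) (*-identityʳ N))

  -- The cycle of u contributes one or two points to rank v but none to rank u.
  rank-gap : ∀ {u v} → u < N → blockMin y u < blockMin y v → rank u + ind< u (y u) < rank v
  rank-gap {u} {v} u<N mu<mv with y u ≟ u
  ... | yes yu≡u = begin-strict
    rank u + ind< u (y u)                 ≡⟨ cong (rank u +_) (trans (cong (ind< u) yu≡u) (ind<-irrefl u)) ⟩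
    rank u + 0                            <⟨ +-monoʳ-< (rank u) (s≤s z≤n) ⟩
    rank u + 1                            ≡⟨ cong (rank u +_) (sum<-ind≡ N u u<N) ⟨
    rank u + sum< N (λ z → ind≡ z u)      ≤⟨ sum<-+-≤ N pointwise ⟩
    rank v                                ∎
    where
    open ≤-Reasoning
    pointwise : ∀ z → ind< (blockMin y z) (blockMin y u) + ind≡ z u ≤ ind< (blockMin y z) (blockMin y v)
    pointwise z with z ≟ u
    ... | yes refl rewrite ind<-irrefl (blockMin y z) | ind≡-refl z | ind<-yes mu<mv = ≤-refl
    ... | no z≢u rewrite ind≡-no z≢u | +-identityʳ (ind< (blockMin y z) (blockMin y u)) =
      ind<-monoʳ-≤ (blockMin y z) (<⇒≤ mu<mv)
  ... | no yu≢u = begin-strict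
    rank u + ind< u (y u)                 ≤⟨ +-monoʳ-≤ (rank u) (ind<≤1 u (y u)) ⟩
    rank u + 1                            <⟨ +-monoʳ-< (rank u) (s≤s (s≤s z≤n)) ⟩
    rank u + (1 + 1)                      ≡⟨ cong (rank u +_) (cong₂ _+_ (sum<-ind≡ N u u<N) (sum<-ind≡ N (y u) yu<N)) ⟨
    rank u + (sum< N (λ z → ind≡ z u) + sum< N (λ z → ind≡ z (y u)))
                                          ≡⟨ cong (rank u +_) (sum<-+ N _ _) ⟨
    rank u + sum< N (λ z → ind≡ z u + ind≡ z (y u))
                                          ≤⟨ sum<-+-≤ N pointwise ⟩
    rank v                                ∎
    where
    open ≤-Reasoning
    yu<N : y u < N
    yu<N = involution-bounded inv above u<N
    pointwise : ∀ z → ind< (blockMin y z) (blockMin y u) + (ind≡ z u + ind≡ z (y u)) ≤ ind< (blockMin y z) (blockMin y v)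
    pointwise z with z ≟ u | z ≟ y u
    ... | yes refl | _ rewrite ind<-irrefl (blockMin y z) | ind≡-refl z | ind≡-no (yu≢u ∘ sym) | ind<-yes mu<mv = ≤-refl
    ... | no z≢u | yes refl = ≤-reflexive (trans
      (cong₂ _+_ (trans (cong (λ m → ind< m (blockMin y u)) myu≡mu) (ind<-irrefl (blockMin y u)))
                 (cong₂ _+_ (ind≡-no z≢u) (ind≡-refl (y u))))
      (sym (ind<-yes (subst (_< blockMin y v) (sym myu≡mu) mu<mv))))
      where
      myu≡mu : blockMin y (y u) ≡ blockMin y u
      myu≡mu = blockMin-involution {y} inv u
    ... | no z≢u | no z≢yu rewrite ind≡-no z≢u | ind≡-no z≢yu | +-identityʳ (ind< (blockMin y z) (blockMin y u)) =
      ind<-monoʳ-≤ (blockMin y z) (<⇒≤ mu<mv)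

  canonical-mono : ∀ {u v} → blockMin y u < blockMin y v → canonical y N u < canonical y N v
  canonical-mono {u} {v} mu<mv with u <? N
  ... | yes u<N = begin-strict
    canonical y N u              ≡⟨ canonical-below u<N ⟩
    rank u + ind< u (y u)        <⟨ rank-gap u<N mu<mv ⟩
    rank v                       ≤⟨ m≤m+n (rank v) _ ⟩
    rank v + ind< v (y v)        ≤⟨ m≤m+n _ (v ∸ N) ⟩
    canonical y N v              ∎
    where open ≤-Reasoning
  ... | no u≮N = subst₂ _<_ (sym (canonical-fixesAbove u N≤u)) (sym (canonical-fixesAbove v N≤v)) u<v
    where
    N≤u : N ≤ u
    N≤u = ≮⇒≥ u≮N
    u<v : u < v
    u<v = <-≤-trans (subst (_< blockMin y v) (trans (cong (u ⊓_) (above u N≤u)) (⊓-idem u)) mu<mv) (m⊓n≤m v (y v))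
    N≤v : N ≤ v
    N≤v = ≤-trans N≤u (<⇒≤ u<v)

  canonical-pair : ∀ {i j} → i < j → y i ≡ j → canonical y N j < canonical y N i
  canonical-pair {i} {j} i<j yi≡j = subst₂ _<_ (sym cj) (sym ci) (m<m+n (rank i) (s≤s z≤n))
    where
    yj≡i : y j ≡ i
    yj≡i = trans (cong y (sym yi≡j)) (inv i)
    ci : canonical y N i ≡ rank i + 1
    ci = trans (canonical-below (moved-below (λ e → <⇒≢ i<j (trans (sym e) yi≡j))))
               (cong (rank i +_) (trans (cong (ind< i) yi≡j) (ind<-yes i<j)))
    cj : canonical y N j ≡ rank i
    cj = begin
      canonical y N j          ≡⟨ canonical-below (moved-below (λ e → <⇒≢ i<j (trans (sym yj≡i) e))) ⟩
      rank j + ind< j (y j)    ≡⟨ cong₂ _+_ (sum<-cong N (λ z _ → cong (ind< (blockMin y z)) mj≡mi))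
                                           (trans (cong (ind< j) yj≡i) (ind<-no (<-asym i<j))) ⟩
      rank i + 0               ≡⟨ +-identityʳ (rank i) ⟩
      rank i                   ∎
      where
      open ≡-Reasoning
      mj≡mi : blockMin y j ≡ blockMin y i
      mj≡mi = trans (cong (blockMin y) (sym yi≡j)) (blockMin-involution {y} inv i)

ind<-sucʳ : ∀ {c k} → c ≢ k → ind< c (suc k) ≡ ind< c k
ind<-sucʳ {c} {k} c≢k with <-cmp c k
... | tri< c<k _ _ = trans (ind<-yes (<-trans c<k (n<1+n k))) (sym (ind<-yes c<k))
... | tri≈ _ c≡k _ = ⊥-elim (c≢k c≡k)
... | tri> _ _ k<c = trans (ind<-no (<⇒≱ k<c ∘ ≤-pred)) (sym (ind<-no (<-asym k<c)))

ind<-sucˡ : ∀ {c k} → c ≢ suc k → ind< (suc k) c ≡ ind< k c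
ind<-sucˡ {c} {k} c≢1+k with <-cmp (suc k) c
... | tri< 1+k<c _ _ = trans (ind<-yes 1+k<c) (sym (ind<-yes (<-trans (n<1+n k) 1+k<c)))
... | tri≈ _ 1+k≡c _ = ⊥-elim (c≢1+k (sym 1+k≡c))
... | tri> _ _ c<1+k = trans (ind<-no (<-asym c<1+k)) (sym (ind<-no (<⇒≱ c<1+k)))

swap-∸ : ∀ {k N} x → suc k < N → swap k x ∸ N ≡ x ∸ N
swap-∸ {k} {N} x k+1<N with x <? N
... | yes x<N = trans (m≤n⇒m∸n≡0 (<⇒≤ (swap-bounded k+1<N x<N))) (sym (m≤n⇒m∸n≡0 (<⇒≤ x<N)))
... | no x≮N = cong (_∸ N) (swap-fixes-above (<-≤-trans k+1<N (≮⇒≥ x≮N)))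

canonical-conj : ∀ y N k → Involutive y → suc k < N → y k ≢ suc k → (∀ u → blockMin y u ≢ suc k) →
  ∀ x → canonical (swap k ∘ y ∘ swap k) N (swap k x) ≡ canonical y N x
canonical-conj y N k inv k+1<N yk≢1+k min≢1+k x =
  cong₂ _+_ (cong₂ _+_ rank′≡rank (trans (cong (ind< (swap k x)) (y′-swap x)) (ind<-swap k x (y x) (not-k,1+k x) (not-1+k,k x))))
            (swap-∸ x k+1<N)
  where
  y′ : Fn
  y′ = swap k ∘ y ∘ swap k
  not-k,1+k : ∀ x → ¬ (x ≡ k × y x ≡ suc k)
  not-k,1+k x (refl , e) = yk≢1+k e
  not-1+k,k : ∀ x → ¬ (x ≡ suc k × y x ≡ k)
  not-1+k,k x (refl , e) = yk≢1+k (trans (cong y (sym e)) (inv (suc k)))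
  y′-swap : ∀ x → y′ (swap k x) ≡ swap k (y x)
  y′-swap x = cong (swap k ∘ y) (swap-involutive k x)
  blockMin′ : ∀ x → blockMin y′ (swap k x) ≡ swap k (blockMin y x)
  blockMin′ x = trans (cong (swap k x ⊓_) (y′-swap x)) (sym (swap-⊓ k x (y x) (not-k,1+k x) (not-1+k,k x)))
  rank′≡rank : sum< N (λ z → ind< (blockMin y′ z) (blockMin y′ (swap k x))) ≡ sum< N (λ z → ind< (blockMin y z) (blockMin y x))
  rank′≡rank = trans (sym (sum<-swap N k (λ z → ind< (blockMin y′ z) (blockMin y′ (swap k x))) k+1<N))
    (sum<-cong N (λ z _ → trans (cong₂ ind< (blockMin′ z) (blockMin′ x))
      (ind<-swap k (blockMin y z) (blockMin y x) (min≢1+k x ∘ proj₂) (min≢1+k z ∘ proj₁))))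

module CanonicalSplit (y : Fn) (N k : ℕ) (inv : Involutive y) (k+1<N : suc k < N) (yk≡1+k : y k ≡ suc k) where

  private
    y′ : Fn
    y′ = y ∘ swap k
    y1+k≡k : y (suc k) ≡ k
    y1+k≡k = trans (cong y (sym yk≡1+k)) (inv k)
    y′1+k : y′ (suc k) ≡ suc k
    y′1+k = trans (cong y (swap-snd k)) yk≡1+k
    m′k : blockMin y′ k ≡ k
    m′k = trans (cong (k ⊓_) (trans (cong y (swap-fst k)) y1+k≡k)) (⊓-idem k)
    m′1+k : blockMin y′ (suc k) ≡ suc k
    m′1+k = trans (cong (suc k ⊓_) y′1+k) (⊓-idem (suc k))
    mk : blockMin y k ≡ k
    mk = trans (cong (k ⊓_) yk≡1+k) (m≤n⇒m⊓n≡m (n≤1+n k))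
    m1+k : blockMin y (suc k) ≡ k
    m1+k = trans (cong (suc k ⊓_) y1+k≡k) (m≥n⇒m⊓n≡n (n≤1+n k))
    1+k∸N : suc k ∸ N ≡ k ∸ N
    1+k∸N = trans (m≤n⇒m∸n≡0 (<⇒≤ k+1<N)) (sym (m≤n⇒m∸n≡0 (<⇒≤ (<-trans (n<1+n k) k+1<N))))
    others : ∀ {z} → z ≢ k → z ≢ suc k → blockMin y′ z ≡ blockMin y z × blockMin y z ≢ k × blockMin y z ≢ suc k
    others {z} z≢k z≢1+k = cong (λ v → z ⊓ y v) (swap-other z≢k z≢1+k) , avoids k z≢k yz≢k , avoids (suc k) z≢1+k yz≢1+k
      where
      yz≢k : y z ≢ k
      yz≢k e = z≢1+k (trans (sym (inv z)) (trans (cong y e) yk≡1+k))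
      yz≢1+k : y z ≢ suc k
      yz≢1+k e = z≢k (trans (sym (inv z)) (trans (cong y e) y1+k≡k))
      avoids : ∀ a → z ≢ a → y z ≢ a → blockMin y z ≢ a
      avoids a z≢a yz≢a e with ⊓-sel z (y z)
      ... | inj₁ m≡z = z≢a (trans (sym m≡z) e)
      ... | inj₂ m≡yz = yz≢a (trans (sym m≡yz) e)

  canonical-split : ∀ x → canonical (y ∘ swap k) N (swap k x) ≡ canonical y N x
  canonical-split x with swapView k x
  ... | at-k rewrite swap-fst k | m′1+k | mk = begin
    sum< N (λ z → ind< (blockMin y′ z) (suc k)) + ind< (suc k) (y′ (suc k)) + (suc k ∸ N)
    ≡⟨ cong₂ _+_ (cong₂ _+_ rank′ (trans (cong (ind< (suc k)) y′1+k) (ind<-irrefl (suc k)))) 1+k∸N ⟩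
    sum< N (λ z → ind< (blockMin y z) k) + 1 + 0 + (k ∸ N)
    ≡⟨ cong (_+ (k ∸ N)) (trans (+-identityʳ _) (cong (sum< N (λ z → ind< (blockMin y z) k) +_) (sym (trans (cong (ind< k) yk≡1+k) (ind<-yes (n<1+n k)))))) ⟩
    sum< N (λ z → ind< (blockMin y z) k) + ind< k (y k) + (k ∸ N) ∎
    where
    open ≡-Reasoning
    pointwise : ∀ z → ind< (blockMin y′ z) (suc k) ≡ ind< (blockMin y z) k + ind≡ z k
    pointwise z with swapView k z
    ... | at-k rewrite m′k | mk | ind<-yes (n<1+n k) | ind<-irrefl k | ind≡-refl k = refl
    ... | at-suc-k rewrite m′1+k | m1+k | ind<-irrefl (suc k) | ind≡-no (n≢1+n k ∘ sym) = refl
    ... | elsewhere z≢k z≢1+k with others z≢k z≢1+k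
    ...   | m′z≡mz , mz≢k , _ =
      trans (cong (λ m → ind< m (suc k)) m′z≡mz)
            (trans (ind<-sucʳ mz≢k) (sym (trans (cong (ind< (blockMin y z) k +_) (ind≡-no z≢k)) (+-identityʳ _))))
    rank′ : sum< N (λ z → ind< (blockMin y′ z) (suc k)) ≡ sum< N (λ z → ind< (blockMin y z) k) + 1
    rank′ = trans (sum<-cong N (λ z _ → pointwise z))
                (trans (sum<-+ N _ _) (cong (sum< N (λ z → ind< (blockMin y z) k) +_) (sum<-ind≡ N k (<-trans (n<1+n k) k+1<N))))
  ... | at-suc-k rewrite swap-snd k | m′k | m1+k =
    cong₂ _+_ (cong₂ _+_ (sum<-cong N (λ z _ → pointwise z)) y-terms) (sym 1+k∸N)
    where
    pointwise : ∀ z → ind< (blockMin y′ z) k ≡ ind< (blockMin y z) k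
    pointwise z with swapView k z
    ... | at-k rewrite m′k | mk = refl
    ... | at-suc-k rewrite m′1+k | m1+k = trans (ind<-no (<-asym (n<1+n k))) (sym (ind<-irrefl k))
    ... | elsewhere z≢k z≢1+k = cong (λ m → ind< m k) (proj₁ (others z≢k z≢1+k))
    y-terms : ind< k (y′ k) ≡ ind< (suc k) (y (suc k))
    y-terms = trans (cong (ind< k) (trans (cong y (swap-fst k)) y1+k≡k))
                    (trans (ind<-irrefl k) (sym (trans (cong (ind< (suc k)) y1+k≡k) (ind<-no (<-asym (n<1+n k))))))
  ... | elsewhere x≢k x≢1+k rewrite swap-other x≢k x≢1+k =
    cong₂ _+_ (cong₂ _+_ (sum<-cong N (λ z _ → pointwise z)) (cong (ind< x ∘ y) (swap-other x≢k x≢1+k))) refl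
    where
    mx : blockMin y′ x ≡ blockMin y x
    mx = proj₁ (others x≢k x≢1+k)
    pointwise : ∀ z → ind< (blockMin y′ z) (blockMin y′ x) ≡ ind< (blockMin y z) (blockMin y x)
    pointwise z rewrite mx with swapView k z
    ... | at-k rewrite m′k | mk = refl
    ... | at-suc-k rewrite m′1+k | m1+k = ind<-sucˡ (proj₂ (proj₂ (others x≢k x≢1+k)))
    ... | elsewhere z≢k z≢1+k = cong (λ m → ind< m (blockMin y x)) (proj₁ (others z≢k z≢1+k))

swap-≥ : ∀ {k v} → k ≤ v → k ≤ swap k v
swap-≥ {k} {v} k≤v with swapView k v
... | at-k = subst (k ≤_) (sym (swap-fst k)) (n≤1+n k)
... | at-suc-k = ≤-reflexive (sym (swap-snd k))
... | elsewhere v≢k v≢1+k = subst (k ≤_) (sym (swap-other v≢k v≢1+k)) k≤v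

record Predecessor (y : Fn) (N k : ℕ) : Set where
  field
    pred              : Fn
    pred-involutive   : Involutive pred
    pred-fixesAbove   : FixesAbove N pred
    pred-ascent       : pred k < pred (suc k)
    demConj-pred      : demConj pred k ≐ y
    canonical-pred    : ∀ x → canonical pred N (swap k x) ≡ canonical y N x
    canonical-descent : canonical y N (suc k) < canonical y N k

predecessor-split : ∀ y N k → Involutive y → FixesAbove N y → suc k < N → y (suc k) ≡ k → Predecessor y N k
predecessor-split y N k inv above k+1<N y1+k≡k = record
  { pred              = y′
  ; pred-involutive   = λ x → trans (cong y (cong (swap k) (commute x))) (trans (cong y (swap-involutive k (y x))) (inv x))
  ; pred-fixesAbove   = λ x N≤x → trans (cong y (swap-fixes-above (<-≤-trans k+1<N N≤x))) (above x N≤x)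
  ; pred-ascent       = subst₂ _<_ (sym y′k) (sym y′1+k) (n<1+n k)
  ; demConj-pred      = λ x → trans (cong-app (demConj-fixesPair y′ k (subst₂ _<_ (sym y′k) (sym y′1+k) (n<1+n k)) (y′k , y′1+k)) x)
                                    (cong y (swap-involutive k x))
  ; canonical-pred    = CanonicalSplit.canonical-split y N k inv k+1<N yk≡1+k
  ; canonical-descent = Canonical.canonical-pair y N inv above (n<1+n k) yk≡1+k
  }
  where
  yk≡1+k : y k ≡ suc k
  yk≡1+k = trans (cong y (sym y1+k≡k)) (inv (suc k))
  y′ : Fn
  y′ = y ∘ swap k
  commute : ∀ x → y (swap k x) ≡ swap k (y x)
  commute x with swapView k x
  ... | at-k = trans (cong y (swap-fst k)) (trans y1+k≡k (sym (trans (cong (swap k) yk≡1+k) (swap-snd k))))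
  ... | at-suc-k = trans (cong y (swap-snd k)) (trans yk≡1+k (sym (trans (cong (swap k) y1+k≡k) (swap-fst k))))
  ... | elsewhere x≢k x≢1+k = trans (cong y (swap-other x≢k x≢1+k)) (sym (swap-other
          (λ e → x≢1+k (trans (sym (inv x)) (trans (cong y e) yk≡1+k)))
          (λ e → x≢k (trans (sym (inv x)) (trans (cong y e) y1+k≡k)))))
  y′k : y′ k ≡ k
  y′k = trans (cong y (swap-fst k)) y1+k≡k
  y′1+k : y′ (suc k) ≡ suc k
  y′1+k = trans (cong y (swap-snd k)) yk≡1+k

predecessor-conj : ∀ y N k → Involutive y → FixesAbove N y → suc k < N → y (suc k) < suc k → ¬ y k < k → y (suc k) ≢ k →
  Predecessor y N k
predecessor-conj y N k inv above k+1<N y1+k<1+k yk≮k y1+k≢k = record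
  { pred              = y′
  ; pred-involutive   = conj-involutive y k inv
  ; pred-fixesAbove   = λ x N≤x → trans (cong (swap k ∘ y) (swap-fixes-above (<-≤-trans k+1<N N≤x)))
                                        (trans (cong (swap k) (above x N≤x)) (swap-fixes-above (<-≤-trans k+1<N N≤x)))
  ; pred-ascent       = ascent
  ; demConj-pred      = λ x → trans (cong-app (demConj-movesPair y′ k ascent (λ (e , _) → <⇒≢ a<k (trans (sym y′k) e))) x)
                                    (trans (cong (swap k ∘ swap k) (cong y (swap-involutive k x))) (swap-involutive k (y x)))
  ; canonical-pred    = canonical-conj y N k inv k+1<N yk≢1+k min≢1+k
  ; canonical-descent = Canonical.canonical-mono y N inv above (≤-<-trans (m⊓n≤n (suc k) (y (suc k)))
                          (subst (y (suc k) <_) (sym (m≤n⇒m⊓n≡m k≤yk)) a<k))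
  }
  where
  a<k : y (suc k) < k
  a<k = ≤∧≢⇒< (≤-pred y1+k<1+k) y1+k≢k
  k≤yk : k ≤ y k
  k≤yk = ≮⇒≥ yk≮k
  yk≢1+k : y k ≢ suc k
  yk≢1+k e = y1+k≢k (trans (cong y (sym e)) (inv k))
  min≢1+k : ∀ u → blockMin y u ≢ suc k
  min≢1+k u e with ⊓-sel u (y u)
  ... | inj₁ mu≡u = <-irrefl e (≤-<-trans (m⊓n≤n u (y u)) (subst (λ v → y v < suc k) (sym u≡1+k) y1+k<1+k))
    where
    u≡1+k : u ≡ suc k
    u≡1+k = trans (sym mu≡u) e
  ... | inj₂ mu≡yu = <-irrefl e (≤-<-trans (m⊓n≤m u (y u)) (subst (_< suc k) (sym u≡a) (<-trans a<k (n<1+n k))))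
    where
    u≡a : u ≡ y (suc k)
    u≡a = trans (sym (inv u)) (cong y (trans (sym mu≡yu) e))
  y′ : Fn
  y′ = swap k ∘ y ∘ swap k
  y′k : y′ k ≡ y (suc k)
  y′k = trans (cong (swap k ∘ y) (swap-fst k)) (swap-other y1+k≢k (<⇒≢ (<-trans a<k (n<1+n k))))
  ascent : y′ k < y′ (suc k)
  ascent = <-≤-trans (subst (_< k) (sym y′k) a<k)
                     (subst (k ≤_) (sym (cong (swap k ∘ y) (swap-snd k))) (swap-≥ k≤yk))

-- If k + 1 is the first point that y moves down, y is a Demazure conjugate of an involution by the
-- ascent s_k, and the canonical atoms of the two differ by s_k on the right.
predecessor : ∀ y N k → Involutive y → FixesAbove N y → suc k < N → y (suc k) < suc k → ¬ y k < k →
  Predecessor y N k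
predecessor y N k inv above k+1<N y1+k<1+k yk≮k with y (suc k) ≟ k
... | yes y1+k≡k = predecessor-split y N k inv above k+1<N y1+k≡k
... | no y1+k≢k = predecessor-conj y N k inv above k+1<N y1+k<1+k yk≮k y1+k≢k

least-below : ∀ (P : ℕ → Set) → (∀ x → Dec (P x)) → ∀ n →
  (∃ λ x → x < n × P x × (∀ z → z < x → ¬ P z)) ⊎ (∀ x → x < n → ¬ P x)
least-below P P? zero = inj₂ (λ _ ())
least-below P P? (suc n) with least-below P P? n
... | inj₁ (x , x<n , Px , least) = inj₁ (x , <-trans x<n (n<1+n n) , Px , least)
... | inj₂ none with P? n
...   | yes Pn = inj₁ (n , n<1+n n , Pn , none)
...   | no ¬Pn = inj₂ λ x x<1+n → case-≤ x (≤-pred x<1+n)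
  where
  case-≤ : ∀ x → x ≤ n → ¬ P x
  case-≤ x x≤n with m≤n⇒m<n∨m≡n x≤n
  ... | inj₁ x<n = none x x<n
  ... | inj₂ refl = ¬Pn

record CanonicalWord (y : Fn) (N : ℕ) : Set where
  field
    word         : List ℕ
    ascentWord   : AscentWord (λ x → x) word
    allAscents   : AllAscents (λ x → x) word
    below        : WordBelow N word
    act-word     : act word ≐ canonical y N
    demConj-word : foldl demConj (λ x → x) word ≐ y

no-descent⇒identity : ∀ {y N} → Involutive y → FixesAbove N y → (∀ x → x < N → ¬ y x < x) → y ≐ (λ x → x)
no-descent⇒identity {y} {N} inv above none x with x <? N
... | no x≮N = above x (≮⇒≥ x≮N)
... | yes x<N with <-cmp (y x) x
...   | tri< yx<x _ _ = ⊥-elim (none x x<N yx<x)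
...   | tri≈ _ yx≡x _ = yx≡x
...   | tri> _ _ x<yx = ⊥-elim (none (y x) (involution-bounded inv above x<N) (subst (_< y x) (sym (inv x)) x<yx))

canonical-identity : ∀ {y} N → y ≐ (λ x → x) → canonical y N ≐ (λ x → x)
canonical-identity {y} N y≐id x = begin
  canonical y N x                          ≡⟨ cong₂ _+_ (cong₂ _+_ (sum<-cong N (λ z _ → cong₂ ind< (min-id z) (min-id x)))
                                                                   (trans (cong (ind< x) (y≐id x)) (ind<-irrefl x))) refl ⟩
  sum< N (λ z → ind< z x) + 0 + (x ∸ N)    ≡⟨ cong (_+ (x ∸ N)) (trans (+-identityʳ _) (sum<-ind< N x)) ⟩
  N ⊓ x + (x ∸ N)                          ≡⟨ [m⊓n]+[n∸m]≡n ⟩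
  x                                        ∎
  where
  open ≡-Reasoning
  min-id : ∀ z → blockMin y z ≡ z
  min-id z = trans (cong (z ⊓_) (y≐id z)) (⊓-idem z)
  [m⊓n]+[n∸m]≡n : N ⊓ x + (x ∸ N) ≡ x
  [m⊓n]+[n∸m]≡n with ≤-total N x
  ... | inj₁ N≤x = trans (cong (_+ (x ∸ N)) (m≤n⇒m⊓n≡m N≤x)) (m+[n∸m]≡n N≤x)
  ... | inj₂ x≤N = trans (cong₂ _+_ (m≥n⇒m⊓n≡n x≤N) (m≤n⇒m∸n≡0 x≤N)) (+-identityʳ x)

canonicalWord-extend : ∀ {y N k} → suc k < N → (P : Predecessor y N k) → CanonicalWord (Predecessor.pred P) N →
  CanonicalWord y N
canonicalWord-extend {y} {N} {k} k+1<N P cw = record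
  { word         = word ++ [ k ]
  ; ascentWord   = ascentWord-++ (λ x → x) word k ascentWord
                     (subst₂ _<_ (sym (trans (act-word k) (trans (cong (canonical pred N) (sym (swap-snd k))) (canonical-pred (suc k)))))
                                 (sym (trans (act-word (suc k)) (trans (cong (canonical pred N) (sym (swap-fst k))) (canonical-pred k))))
                                 canonical-descent)
  ; allAscents   = allAscents-++ (λ x → x) word k allAscents
                     (subst₂ _<_ (sym (demConj-word k)) (sym (demConj-word (suc k))) pred-ascent)
  ; below        = ++⁺ below (k+1<N ∷ [])
  ; act-word     = λ x → trans (act-++ word [ k ] x) (trans (act-word (swap k x)) (canonical-pred x))
  ; demConj-word = λ x → trans (cong-app (foldl-++ demConj (λ x → x) word [ k ]) x)
                               (trans (demConj-cong k demConj-word x) (demConj-pred x))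
  }
  where
  open Predecessor P
  open CanonicalWord cw

-- Peel off predecessors until y is the identity; the weight drops by 2 at each step.
canonicalWord : ∀ N y → Involutive y → FixesAbove N y → Acc _<_ (weight N y) → CanonicalWord y N
canonicalWord N y inv above (acc smaller) with least-below (λ x → y x < x) (λ x → y x <? x) N
... | inj₂ none = record
  { word = [] ; ascentWord = tt ; allAscents = tt ; below = []
  ; act-word = λ x → sym (canonical-identity N (no-descent⇒identity inv above none) x)
  ; demConj-word = λ x → sym (no-descent⇒identity inv above none x) }
... | inj₁ (zero , _ , () , _)
... | inj₁ (suc k , k+1<N , y1+k<1+k , least) =
  canonicalWord-extend k+1<N P (canonicalWord N pred pred-involutive pred-fixesAbove (smaller weight-drops))
  where
  P : Predecessor y N k
  P = predecessor y N k inv above k+1<N y1+k<1+k (least k (n<1+n k))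
  open Predecessor P
  weight-drops : weight N pred < weight N y
  weight-drops = subst (weight N pred <_)
    (trans (sym (weight-demConj-ascent N k pred pred-involutive pred-fixesAbove k+1<N pred-ascent)) (weight-cong N demConj-pred))
    (m<n+m (weight N pred) {2} (s≤s z≤n))

InvertsCycles : Fn → Fn → Set
InvertsCycles u z = ∀ x → x < z x → u (z x) < u x

invertsCycles-conj : ∀ u z k → z k < z (suc k) → Involutive z → InvertsCycles u z →
  InvertsCycles (u ∘ swap k) (swap k ∘ z ∘ swap k)
invertsCycles-conj u z k asc inv inverts x x<z′x =
  subst (λ v → u v < u (swap k x)) (sym (swap-involutive k (z (swap k x))))
    (inverts (swap k x) (swap-reflects-< k (subst (_< swap k (z (swap k x))) (sym (swap-involutive k x)) x<z′x) not-1+k,k))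
  where
  not-1+k,k : ¬ (swap k x ≡ suc k × z (swap k x) ≡ k)
  not-1+k,k (e₁ , e₂) = <-asym asc (subst₂ _<_ (sym z1+k≡k) (sym zk≡1+k) (n<1+n k))
    where
    z1+k≡k : z (suc k) ≡ k
    z1+k≡k = trans (cong z (sym e₁)) e₂
    zk≡1+k : z k ≡ suc k
    zk≡1+k = trans (cong z (sym z1+k≡k)) (inv (suc k))

invertsCycles-demConj : ∀ u z k → u k < u (suc k) → z k < z (suc k) → Involutive z → InvertsCycles u z →
  InvertsCycles (u ∘ swap k) (demConj z k)
invertsCycles-demConj u z k uasc zasc inv inverts with demConjView z k
... | descent ¬asc = ⊥-elim (¬asc zasc)
... | moved asc ¬fix rewrite demConj-movesPair z k asc ¬fix = invertsCycles-conj u z k asc inv inverts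
... | fixed asc (fk , f1+k) rewrite demConj-fixesPair z k asc (fk , f1+k) = inverts′
  where
  inverts′ : InvertsCycles (u ∘ swap k) (z ∘ swap k)
  inverts′ x x<z′x with swapView k x
  ... | at-k rewrite swap-fst k | f1+k | swap-snd k = uasc
  ... | at-suc-k rewrite swap-snd k | fk = ⊥-elim (<-asym x<z′x (n<1+n k))
  ... | elsewhere x≢k x≢1+k rewrite swap-other x≢k x≢1+k =
    subst (λ v → u v < u x) (sym (swap-other (x≢k ∘ λ e → trans (sym (inv x)) (trans (cong z e) fk))
                                              (x≢1+k ∘ λ e → trans (sym (inv x)) (trans (cong z e) f1+k))))
          (inverts x x<z′x)

invertsCycles-foldl : ∀ b u z → AscentWord u b → AllAscents z b → Involutive z → InvertsCycles u z →
  InvertsCycles (u ∘ act b) (foldl demConj z b)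
invertsCycles-foldl [] u z _ _ _ inverts = inverts
invertsCycles-foldl (k ∷ b) u z (uasc , uascs) (zasc , zascs) inv inverts =
  invertsCycles-foldl b (u ∘ swap k) (demConj z k) uascs zascs (demConj-involutive z k inv)
    (invertsCycles-demConj u z k uasc zasc inv inverts)

invertsCycles-cong : ∀ {u u' z z'} → u ≐ u' → z ≐ z' → InvertsCycles u z → InvertsCycles u' z'
invertsCycles-cong {u} {u'} {z} {z'} u≐u' z≐z' inverts x x<z'x =
  subst₂ _<_ (trans (u≐u' (z x)) (cong u' (z≐z' x))) (u≐u' x) (inverts x (subst (x <_) (sym (z≐z' x)) x<z'x))

-- α_min(y) is the canonical atom

count-below-act : ∀ N b t → WordBelow N b → sum< N (λ x → ind< (act b x) t) ≡ N ⊓ t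
count-below-act N b t below = trans (sum<-act N b (λ v → ind< v t) below) (sum<-ind< N t)

module AlphaMinimal (y : Fn) (N : ℕ) (inv : Involutive y) (above : FixesAbove N y) where

  open Canonical y N inv above using (canonical-mono; canonical-pair; canonical-fixesAbove)
  open CanonicalWord (canonicalWord N y inv above (<-wellFounded (weight N y)))

  c : Fn
  c = canonical y N

  visible⇒inversion : ∀ {i j} → VisInv y i j → Inv c i j
  visible⇒inversion {i} {j} (i<j , yj≤i⊓yi) with <-cmp (blockMin y j) (blockMin y i)
  ... | tri< mj<mi _ _ = i<j , canonical-mono mj<mi
  ... | tri> _ _ mi<mj = ⊥-elim (<⇒≱ mi<mj (≤-trans (m⊓n≤n j (y j)) yj≤i⊓yi))
  ... | tri≈ _ mj≡mi _ with same-block inv mj≡mi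
  ...   | inj₁ j≡i = ⊥-elim (<⇒≢ i<j (sym j≡i))
  ...   | inj₂ j≡yi = i<j , canonical-pair i<j (sym j≡yi)

  inversion⇒visible : ∀ {i j} → Inv c i j → VisInv y i j
  inversion⇒visible {i} {j} (i<j , cj<ci) with <-cmp (blockMin y j) (blockMin y i)
  ... | tri> _ _ mi<mj = ⊥-elim (<-asym cj<ci (canonical-mono mi<mj))
  ... | tri≈ _ mj≡mi _ with same-block inv mj≡mi
  ...   | inj₁ j≡i = ⊥-elim (<⇒≢ i<j (sym j≡i))
  ...   | inj₂ j≡yi = i<j , subst (_≤ i ⊓ y i) (sym yj≡i) (⊓-glb ≤-refl (subst (i ≤_) j≡yi (<⇒≤ i<j)))
    where
    yj≡i : y j ≡ i
    yj≡i = trans (cong y j≡yi) (inv i)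
  inversion⇒visible {i} {j} (i<j , cj<ci) | tri< mj<mi _ _ with ⊓-sel j (y j)
  ... | inj₁ mj≡j = ⊥-elim (<-asym i<j (<-≤-trans (subst (_< blockMin y i) mj≡j mj<mi) (m⊓n≤m i (y i))))
  ... | inj₂ mj≡yj = i<j , <⇒≤ (subst (_< blockMin y i) mj≡yj mj<mi)

  sent-below : ∀ {w k} → InvertsCycles w y → (∀ i → i < k → w i ≡ c i) → w k < c k →
    ∀ x → x ≢ k → c x < c k → w x < c k
  sent-below {w} {k} inverts agree wk<ck x x≢k cx<ck with <-cmp x k
  ... | tri< x<k _ _ = subst (_< c k) (sym (agree x x<k)) cx<ck
  ... | tri≈ _ x≡k _ = ⊥-elim (x≢k x≡k)
  ... | tri> _ _ k<x with <-cmp (blockMin y x) (blockMin y k)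
  ...   | tri> _ _ mk<mx = ⊥-elim (<-asym cx<ck (canonical-mono mk<mx))
  ...   | tri≈ _ mx≡mk _ with same-block inv mx≡mk
  ...     | inj₁ x≡k = ⊥-elim (x≢k x≡k)
  ...     | inj₂ x≡yk = subst (λ v → w v < c k) (sym x≡yk) (<-trans (inverts k (subst (k <_) x≡yk k<x)) wk<ck)
  sent-below {w} {k} inverts agree wk<ck x x≢k cx<ck | tri> _ _ k<x | tri< mx<mk _ _ with ⊓-sel x (y x)
  ...     | inj₁ mx≡x = ⊥-elim (<-asym k<x (<-≤-trans (subst (_< blockMin y k) mx≡x mx<mk) (m⊓n≤m k (y k))))
  ...     | inj₂ mx≡yx = <-trans wx<wa (subst (_< c k) (sym (agree a a<k)) (canonical-mono ma<mk))
    where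
    a : ℕ
    a = y x
    a<k : a < k
    a<k = <-≤-trans (subst (_< blockMin y k) mx≡yx mx<mk) (m⊓n≤m k (y k))
    ma<mk : blockMin y a < blockMin y k
    ma<mk = subst (_< blockMin y k) (sym (blockMin-involution {y} inv x)) mx<mk
    wx<wa : w x < w a
    wx<wa = subst (λ v → w v < w a) (inv x) (inverts a (subst (a <_) (sym (inv x)) (<-trans a<k k<x)))

  -- If w k < c k, then w sends k and every point that c sends below c k below c k: one point more than c,
  -- although both permute {0, …, N - 1}.
  canonical-lexMinimal : ∀ {w bw} → WordBelow N bw → act bw ≐ w → InvertsCycles w y →
    ∀ k → (∀ i → i < k → w i ≡ c i) → ¬ w k < c k
  canonical-lexMinimal {w} {bw} bw-below act≐w inverts k agree wk<ck with k <? N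
  ... | no k≮N = <-irrefl (trans (sym (act≐w k)) (trans (act-fixes-above bw bw-below N≤k) (sym (canonical-fixesAbove k N≤k)))) wk<ck
    where
    N≤k : N ≤ k
    N≤k = ≮⇒≥ k≮N
  ... | yes k<N = <⇒≱ (m<m+n (N ⊓ c k) (s≤s z≤n)) (begin
    N ⊓ c k + 1                                                  ≡⟨ cong₂ _+_ count-c (sum<-ind≡ N k k<N) ⟨
    sum< N (λ x → ind< (c x) (c k)) + sum< N (λ x → ind≡ x k)    ≤⟨ sum<-+-≤ N pointwise ⟩
    sum< N (λ x → ind< (w x) (c k))                              ≡⟨ count-w ⟩
    N ⊓ c k                                                      ∎)
    where
    open ≤-Reasoning
    count-c : sum< N (λ x → ind< (c x) (c k)) ≡ N ⊓ c k
    count-c = trans (sum<-cong N (λ x _ → cong (λ v → ind< v (c k)) (sym (act-word x)))) (count-below-act N word (c k) below)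
    count-w : sum< N (λ x → ind< (w x) (c k)) ≡ N ⊓ c k
    count-w = trans (sum<-cong N (λ x _ → cong (λ v → ind< v (c k)) (sym (act≐w x)))) (count-below-act N bw (c k) bw-below)
    pointwise : ∀ x → ind< (c x) (c k) + ind≡ x k ≤ ind< (w x) (c k)
    pointwise x with x ≟ k
    ... | yes refl rewrite ind<-irrefl (c x) | ind≡-refl x | ind<-yes wk<ck = ≤-refl
    ... | no x≢k rewrite ind≡-no x≢k | +-identityʳ (ind< (c x) (c k)) with c x <? c k
    ...   | yes cx<ck rewrite ind<-yes cx<ck | ind<-yes (sent-below inverts agree wk<ck x x≢k cx<ck) = ≤-refl
    ...   | no cx≮ck rewrite ind<-no cx≮ck = z≤n

  canonical-reduced : Reduced word c
  canonical-reduced = act-word , λ b b≐c → ascentWord⇒minimal word ascentWord b (λ x → trans (b≐c x) (sym (act-word x)))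

  canonical-inverse : IsInverse (act (reverse word)) c
  canonical-inverse = (λ x → trans (cong (act (reverse word)) (sym (act-word x))) (act-reverse-act word x))
                    , (λ x → trans (sym (act-word _)) (act-act-reverse word x))

  canonical-finPerm : FinPerm c
  canonical-finPerm = (act (reverse word) , canonical-inverse) , (N , canonical-fixesAbove)

  canonical-invDem : InvDem y c
  canonical-invDem = act (reverse word) , canonical-inverse , reverse word , word , reduced-reverse , canonical-reduced ,
    λ x → trans (demazure-inverse (reverse word) word reduced-reverse canonical-reduced canonical-inverse x) (demConj-word x)
    where
    reduced-reverse : Reduced (reverse word) (act (reverse word))
    reduced-reverse = (λ _ → refl) , reverse-minimal word (ascentWord⇒minimal word ascentWord)

  -- Each ascent of a Demazure-conjugation word for y raises the weight by 2, so all such words have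
  -- as many ascents as the canonical word has letters.
  ascentCount≡length-word : ∀ {b} → WordBelow N b → foldl demConj (λ x → x) b ≐ y → ascentCount (λ x → x) b ≡ length word
  ascentCount≡length-word {b} b-below demConj-b =
    *-cancelˡ-≡ _ _ 2 (+-cancelʳ-≡ (weight N id) _ _ (trans (sym (weight-of b b-below demConj-b))
      (trans (weight-of word below demConj-word) (cong (λ n → 2 * n + weight N id) (allAscents⇒ascentCount≡length id word allAscents)))))
    where
    id : Fn
    id x = x
    weight-of : ∀ b → WordBelow N b → foldl demConj id b ≐ y → weight N y ≡ 2 * ascentCount id b + weight N id
    weight-of b b-below demConj-b =
      trans (weight-cong N (λ x → sym (demConj-b x))) (weight-foldl-demConj N b id (λ _ → refl) (λ _ _ → refl) b-below)

  canonical-shortest : ∀ {b} → WordBelow N b → foldl demConj (λ x → x) b ≐ y → length word ≤ length b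
  canonical-shortest {b} b-below demConj-b =
    subst (_≤ length b) (ascentCount≡length-word b-below demConj-b) (ascentCount≤length (λ x → x) b)

  module _ {w b} (atom : IsAtom y w) (b-below : WordBelow N b) (rb : Reduced b w)
           (demConj-b : foldl demConj (λ x → x) b ≐ y) where

    private
      minimal : ∀ v → FinPerm v → InvDem y v → ∀ a′ b′ → Reduced a′ w → Reduced b′ v → length a′ ≤ length b′
      minimal = proj₂ (proj₂ atom)

    canonical-isAtom : IsAtom y c
    canonical-isAtom = canonical-finPerm , canonical-invDem ,
      λ v fp-v invDem-v a′ b′ ra′ rb′ →
        ≤-trans (proj₂ ra′ word act-word) (≤-trans (canonical-shortest b-below demConj-b) (minimal v fp-v invDem-v b b′ rb rb′))

    -- By minimality b is no longer than the canonical word, so all its letters are ascents.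
    atom-invertsCycles : InvertsCycles w y
    atom-invertsCycles = invertsCycles-cong (proj₁ rb) demConj-b
      (invertsCycles-foldl b (λ x → x) (λ x → x) (reduced⇒ascentWord rb) all-ascents (λ _ → refl) (λ x x<x → ⊥-elim (n≮n x x<x)))
      where
      all-ascents : AllAscents (λ x → x) b
      all-ascents = ascentCount≥length⇒allAscents (λ x → x) b
        (subst (length b ≤_) (sym (ascentCount≡length-word b-below demConj-b))
               (minimal c canonical-finPerm canonical-invDem b word rb canonical-reduced))

  alphaMin≐canonical : ∀ {w b} → IsAlphaMin y w → WordBelow N b → Reduced b w → foldl demConj (λ x → x) b ≐ y → w ≐ c
  alphaMin≐canonical (atom , lexMin) b-below rb demConj-b with lexMin c (canonical-isAtom atom b-below rb demConj-b)
  ... | inj₁ w≐c = w≐c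
  ... | inj₂ (k , agree , wk<ck) =
    ⊥-elim (canonical-lexMinimal b-below (proj₁ rb) (atom-invertsCycles atom b-below rb demConj-b) k agree wk<ck)

Inv-cong : ∀ {u v i j} → u ≐ v → Inv u i j → Inv v i j
Inv-cong {i = i} {j} u≐v (i<j , uj<ui) = i<j , subst₂ _<_ (u≐v j) (u≐v i) uj<ui

lemma4p11 : (y : ℕ → ℕ) → IsInvolution y → (w : ℕ → ℕ) → IsAlphaMin y w →
    (i j : ℕ) → (VisInv y i j → Inv w i j) × (Inv w i j → VisInv y i j)
lemma4p11 y (inv , N₀ , above₀) w alphaMin@((_ , (_ , g-inverse , a , b , ra , rb , dem≐y) , _) , _) i j =
  (λ visible → Inv-cong (λ x → sym (w≐c x)) (visible⇒inversion visible)) ,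
  (λ inversion → inversion⇒visible (Inv-cong w≐c inversion))
  where
  N : ℕ
  N = N₀ ⊔ wordBound b
  above : FixesAbove N y
  above x N≤x = above₀ x (≤-trans (m≤m⊔n N₀ (wordBound b)) N≤x)
  open AlphaMinimal y N inv above
  w≐c : w ≐ canonical y N
  w≐c = alphaMin≐canonical alphaMin (wordBelow-wordBound b (m≤n⊔m N₀ (wordBound b)))
          rb (λ x → trans (sym (demazure-inverse a b ra rb g-inverse x)) (dem≐y x))
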